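{- Let $\mathcal{G}$ be a computable colored graph of constant degree, i.e. $\deg_{\mathcal{G}}$ is a constant (finite) function. Then every $\mathcal{G}$-computable function is computable (in the ordinary sense).
   Context: Notation. $\mathfrak{P}_{<\omega}(Y)$ denotes the set of finite subsets of $Y$. For a tuple-valued function $f$, $f_{[k]}$ denotes its $k$-th coordinate. Computable sets are computable subsets of $\mathbb{N}$, or of finite disjoint unions of finite sets and copies of $\mathbb{N}^k$, coded by standard computable bijections. Colored graphs. A colored graph is $\mathcal{G}=(G,(L,V),(C,E),\gamma)$ with vertex set $G$, label set $L$, labeling $V\colon G\to L$, color set $C$, edge coloring $E\colon G\times G\to\mathfrak{P}_{<\omega}(C)$, and $\gamma\colon L\to\mathfrak{P}_{<\omega}(C)$ with $E(v,w)\subseteq\gamma(V(v))\cap\gamma(V(w))$. It is computable if $G,L,C$ are computable sets and $V,E,\gamma$ are computable. The degree of $v$ is $\deg_{\mathcal{G}}(v)=|\{w: E(v,w)\cup E(w,v)\neq\emptyset\}|$. Graph machines. A $\mathcal{G}$-machine is $\mathfrak{M}=(\mathcal{G},(\mathfrak{A},\{0,1\}),(S,s,\alpha),T)$ with: - a finite alphabet $\mathfrak{A}\ni0,1$; - a countable state set $S$; - a state assignment $\alpha\colon L\to\mathfrak{P}_{<\omega}(S)$; - an initial state $s\in\alpha(\ell)$ for all $\ell$; - a lookup table $T\colon L\times\mathfrak{P}_{<\omega}(C)\times\mathfrak{A}\times S\to\mathfrak{P}_{<\omega}(C)\times\mathfrak{A}\times S$. The lookup table satisfies three conditions: - $T(\ell,c,z,t)=(c,z,t)$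 if $c\not\subseteq\gamma(\ell)$ or $t\notin\alpha(\ell)$; - when $c\subseteq\gamma(\ell)$ and $t\in\alpha(\ell)$, $T_{[1]}(\ell,c,z,t)\subseteq\gamma(\ell)$ and $T_{[3]}(\ell,c,z,t)\in\alpha(\ell)$; - $T(\ell,\emptyset,0,s)=(\emptyset,0,s)$. The machine is computable if $S$, $\alpha$ and $T$ are computable. Runs. A valid configuration is $f\colon G\to\mathfrak{P}_{<\omega}(C)\times\mathfrak{A}\times S$ with $f_{[1]}(v)\subseteq\gamma(V(v))$ and $f_{[3]}(v)\in\alpha(V(v))$. The run is given by $\langle\mathfrak{M},f\rangle(v,0)=f(v)$ and $\langle\mathfrak{M},f\rangle(v,n+1)=T(V(v),X,z,t)$, where $z,t$ are the 2nd and 3rd coordinates at stage $n$ and $X=\bigcup_{w}(E(w,v)\cap\langle\mathfrak{M},f\rangle_{[1]}(w,n))$. It halts at stage $n$ if the stage-$n$ and stage-$(n+1)$ configurations coincide. The function $\{\mathfrak{M}\}$. $\mathfrak{A}^{<Y}$ denotes the set of finitely supported functions $Y\to\mathfrak{A}$. For $x\in\mathfrak{A}^{<G}$, $\hat{x}(v)=(\emptyset,x(v),s)$. $\{\mathfrak{M}\}(x)$ is undefined if the run on $\hat{x}$ never halts; otherwise it maps $v$ to its displayed symbol at the least halting stage. $\mathcal{G}$-computability. For infinite computable $X\subseteq G$, $\zeta\colon\mathfrak{A}^{<X}\to\mathfrak{A}^X$ is $\langle\mathcal{G},X\rangle$-computable via $\mathfrak{M}$ if: - (a) $\{\mathfrak{M}\}$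 is total; - (b) $x|_X=y|_X$ implies $\{\mathfrak{M}\}(x)=\{\mathfrak{M}\}(y)$; - (c) $\{\mathfrak{M}\}(x)(v)=0$ for $v\notin X$; - (d) $\{\mathfrak{M}\}(x)|_X=\zeta(x|_X)$. $\zeta$ is $\mathcal{G}$-computable if this holds for some computable $\mathcal{G}$-machine and some infinite computable $X$. Computability of $\zeta$ refers to the map $(x,v)\mapsto\zeta(x)(v)$. -}

module Defs where

open import Data.Nat using (ℕ; zero; suc; _+_; _≤_; _<_; _/_; _%_; _^_)
open import Data.Nat.DivMod using (_mod_)
open import Data.Fin using (Fin; toℕ) renaming (zero to fzero)
open import Data.Vec using (Vec; []; _∷_; head)
open import Data.Bool using (Bool; true; false; if_then_else_)
open import Data.List using (List; length)
open import Data.List.Membership.Propositional using (_∈_)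
open import Data.List.Relation.Unary.Unique.Propositional using (Unique)
open import Data.Product using (Σ; ∃; _×_; _,_; proj₁; proj₂)
open import Data.Sum using (_⊎_)
open import Relation.Nullary using (¬_)
open import Relation.Binary.PropositionalEquality using (_≡_; _≢_)
open import Function.Bundles using (_⇔_)

data PR : ℕ → Set where
  zeroF : ∀ {n} → PR n
  succF : PR 1
  proj  : ∀ {n} → Fin n → PR n
  comp  : ∀ {m n} → PR m → Vec (PR n) m → PR n
  prim  : ∀ {n} → PR n → PR (suc (suc n)) → PR (suc n)
  mu    : ∀ {n} → PR (suc n) → PR n

lookupV : ∀ {n} → Vec ℕ n → Fin n → ℕ
lookupV (x ∷ xs) fzero = x
lookupV (x ∷ xs) (Fin.suc i) = lookupV xs i

mutual
  data _⟨_⟩⇓_ : ∀ {n} → PR n → Vec ℕ n → ℕ → Set where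
    ev-zero : ∀ {n} {xs : Vec ℕ n} → zeroF ⟨ xs ⟩⇓ 0
    ev-succ : ∀ {x} → succF ⟨ x ∷ [] ⟩⇓ suc x
    ev-proj : ∀ {n} {xs : Vec ℕ n} (i : Fin n) → proj i ⟨ xs ⟩⇓ lookupV xs i
    ev-comp : ∀ {m n} {f : PR m} {gs : Vec (PR n) m} {xs : Vec ℕ n}
                {ys : Vec ℕ m} {y : ℕ} →
              gs ⟪ xs ⟫⇓ ys → f ⟨ ys ⟩⇓ y → comp f gs ⟨ xs ⟩⇓ y
    ev-prim0 : ∀ {n} {g : PR n} {h : PR (suc (suc n))} {xs : Vec ℕ n} {y : ℕ} →
               g ⟨ xs ⟩⇓ y → prim g h ⟨ 0 ∷ xs ⟩⇓ y
    ev-primS : ∀ {n} {g : PR n} {h : PR (suc (suc n))} {xs : Vec ℕ n} {k r y : ℕ} →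
               prim g h ⟨ k ∷ xs ⟩⇓ r → h ⟨ k ∷ r ∷ xs ⟩⇓ y →
               prim g h ⟨ suc k ∷ xs ⟩⇓ y
    ev-mu : ∀ {n} {f : PR (suc n)} {xs : Vec ℕ n} {y : ℕ} →
            f ⟨ y ∷ xs ⟩⇓ 0 →
            (∀ i → i < y → Σ ℕ λ z → f ⟨ i ∷ xs ⟩⇓ suc z) →
            mu f ⟨ xs ⟩⇓ y

  data _⟪_⟫⇓_ : ∀ {m n} → Vec (PR n) m → Vec ℕ n → Vec ℕ m → Set where
    evs-[] : ∀ {n} {xs : Vec ℕ n} → [] ⟪ xs ⟫⇓ []
    evs-∷  : ∀ {m n} {g : PR n} {gs : Vec (PR n) m} {xs : Vec ℕ n} {y : ℕ} {ys : Vec ℕ m} →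
             g ⟨ xs ⟩⇓ y → gs ⟪ xs ⟫⇓ ys → (g ∷ gs) ⟪ xs ⟫⇓ (y ∷ ys)

ComputableOn : (n : ℕ) → (Vec ℕ n → Set) → (Vec ℕ n → ℕ) → Set
ComputableOn n D f = Σ (PR n) λ c → ∀ xs → D xs → c ⟨ xs ⟩⇓ f xs

Computable : (n : ℕ) → (Vec ℕ n → ℕ) → Set
Computable n f = Σ (PR n) λ c → ∀ xs → c ⟨ xs ⟩⇓ f xs

bool→ℕ : Bool → ℕ
bool→ℕ true = 1
bool→ℕ false = 0

record CSet : Set where
  field
    χ      : ℕ → Bool
    χ-comp : Computable 1 (λ xs → bool→ℕ (χ (head xs)))

_∈ᶜ_ : ℕ → CSet → Set
n ∈ᶜ A = CSet.χ A n ≡ true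

Infinite : CSet → Set
Infinite A = ∀ n → Σ ℕ λ m → n ≤ m × m ∈ᶜ A

-- Finite subsets of ℕ, coded by naturals (canonical binary coding:
-- i belongs to the set coded by s iff bit i of s is 1).

FinSet : Set
FinSet = ℕ

bit : FinSet → ℕ → ℕ
bit s zero = s % 2
bit s (suc i) = bit (s / 2) i

_∈ₛ_ : ℕ → FinSet → Set
i ∈ₛ s = bit s i ≡ 1

∅ₛ : FinSet
∅ₛ = 0

_⊆ₛ_ : FinSet → FinSet → Set
s ⊆ₛ t = ∀ i → i ∈ₛ s → i ∈ₛ t

_⊆ᶜ_ : FinSet → CSet → Set
s ⊆ᶜ A = ∀ i → i ∈ₛ s → i ∈ᶜ A

HasSize : (ℕ → Set) → ℕ → Set
HasSize P d = Σ (List ℕ) λ xs → Unique xs × length xs ≡ d × (∀ w → P w ⇔ (w ∈ xs))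

record CGraph : Set where
  field
    G L C : CSet
    V     : ℕ → ℕ
    E     : ℕ → ℕ → FinSet
    γ     : ℕ → FinSet
    V-L   : ∀ v → v ∈ᶜ G → V v ∈ᶜ L
    γ-C   : ∀ l → l ∈ᶜ L → γ l ⊆ᶜ C
    E-γ   : ∀ v w → v ∈ᶜ G → w ∈ᶜ G →
            (∀ c → c ∈ₛ E v w → c ∈ₛ γ (V v) × c ∈ₛ γ (V w))
    V-comp : ComputableOn 1 (λ xs → head xs ∈ᶜ G) (λ xs → V (head xs))
    E-comp : ComputableOn 2 (λ { (v ∷ w ∷ []) → v ∈ᶜ G × w ∈ᶜ G })
                            (λ { (v ∷ w ∷ []) → E v w })
    γ-comp : ComputableOn 1 (λ xs → head xs ∈ᶜ L) (λ xs → γ (head xs))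

module _ (𝒢 : CGraph) where
  open CGraph 𝒢

  Adj : ℕ → ℕ → Set
  Adj v w = w ∈ᶜ G × (E v w ≢ ∅ₛ ⊎ E w v ≢ ∅ₛ)

  ConstantDegree : Set
  ConstantDegree = Σ ℕ λ d → ∀ v → v ∈ᶜ G → HasSize (Adj v) d

-- Graph machines over alphabet Fin (2 + a)   (0 = fzero, 1 = fsuc fzero).

module _ (𝒢 : CGraph) (a : ℕ) where
  open CGraph 𝒢

  Alph : Set
  Alph = Fin (suc (suc a))

  Config : Set
  Config = FinSet × Alph × ℕ   -- (colors emitted, displayed symbol, state)

  record Machine : Set where
    field
      S  : CSet
      s  : ℕ
      α  : ℕ → FinSet
      T  : ℕ → FinSet → Alph → ℕ → Config
      s-S  : s ∈ᶜ S
      α-S  : ∀ l → l ∈ᶜ L → α l ⊆ᶜ S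
      s-α  : ∀ l → l ∈ᶜ L → s ∈ₛ α l
      T-id  : ∀ l c z t → l ∈ᶜ L → c ⊆ᶜ C → t ∈ᶜ S →
              (¬ (c ⊆ₛ γ l) ⊎ ¬ (t ∈ₛ α l)) → T l c z t ≡ (c , z , t)
      T-in  : ∀ l c z t → l ∈ᶜ L → c ⊆ᶜ C → t ∈ᶜ S →
              c ⊆ₛ γ l → t ∈ₛ α l →
              proj₁ (T l c z t) ⊆ₛ γ l × proj₂ (proj₂ (T l c z t)) ∈ₛ α l
      T-rest : ∀ l → l ∈ᶜ L → T l ∅ₛ fzero s ≡ (∅ₛ , fzero , s)

  TDom : Machine → Vec ℕ 4 → Set
  TDom M (l ∷ c ∷ z ∷ t ∷ []) =
    l ∈ᶜ L × c ⊆ᶜ C × Σ (z < suc (suc a)) (λ _ → t ∈ᶜ Machine.S M)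

  Tℕ : Machine → Vec ℕ 4 → Config
  Tℕ M (l ∷ c ∷ z ∷ t ∷ []) = Machine.T M l c (z mod suc (suc a)) t

  record ComputableMachine (M : Machine) : Set where
    open Machine M
    field
      α-comp  : ComputableOn 1 (λ xs → head xs ∈ᶜ L) (λ xs → α (head xs))
      T₁-comp : ComputableOn 4 (TDom M) (λ xs → proj₁ (Tℕ M xs))
      T₂-comp : ComputableOn 4 (TDom M) (λ xs → toℕ (proj₁ (proj₂ (Tℕ M xs))))
      T₃-comp : ComputableOn 4 (TDom M) (λ xs → proj₂ (proj₂ (Tℕ M xs)))

  module _ (M : Machine) where
    open Machine M

    hat : (ℕ → Alph) → ℕ → Config
    hat x v = (∅ₛ , x v , s)

    -- r is the run ⟨M, f⟩ (r n v = configuration of v at stage n)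
    IsRun : (ℕ → Config) → (ℕ → ℕ → Config) → Set
    IsRun f r =
      (∀ v → v ∈ᶜ G → r 0 v ≡ f v) ×
      (∀ n v → v ∈ᶜ G →
        Σ FinSet λ X →
          (∀ c → c ∈ₛ X ⇔ (Σ ℕ λ w → w ∈ᶜ G × c ∈ₛ E w v × c ∈ₛ proj₁ (r n w))) ×
          r (suc n) v ≡ T (V v) X (proj₁ (proj₂ (r n v))) (proj₂ (proj₂ (r n v))))

    HaltsAt : (ℕ → ℕ → Config) → ℕ → Set
    HaltsAt r n = ∀ v → v ∈ᶜ G → r n v ≡ r (suc n) v

    FinSupp : (ℕ → Alph) → Set
    FinSupp x = Σ ℕ λ b → ∀ v → v ∈ᶜ G → b ≤ v → x v ≡ fzero

    MOut : (ℕ → Alph) → (ℕ → Alph) → Set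
    MOut x y = Σ (ℕ → ℕ → Config) λ r → IsRun (hat x) r ×
               Σ ℕ λ n → HaltsAt r n × (∀ m → m < n → ¬ HaltsAt r m) ×
               (∀ v → v ∈ᶜ G → y v ≡ proj₁ (proj₂ (r n v)))

  -- x|_X, as an element of 𝔄^{<X} (extended by 0 outside X)
  restrict : CSet → (ℕ → Alph) → ℕ → Alph
  restrict X x v = if CSet.χ X v then x v else fzero

  ComputableVia : (ζ : (ℕ → Alph) → ℕ → Alph) → CSet → Machine → Set
  ComputableVia ζ X M =
    (∀ x → FinSupp M x → Σ (ℕ → Alph) λ y → MOut M x y) ×
    (∀ x x' y y' → FinSupp M x → FinSupp M x' →
       (∀ v → v ∈ᶜ X → x v ≡ x' v) → MOut M x y → MOut M x' y' →
       ∀ v → v ∈ᶜ G → y v ≡ y' v) ×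
    (∀ x y → FinSupp M x → MOut M x y → ∀ v → v ∈ᶜ G → ¬ (v ∈ᶜ X) → y v ≡ fzero) ×
    (∀ x y → FinSupp M x → MOut M x y → ∀ v → v ∈ᶜ X → y v ≡ ζ (restrict X x) v)

  GComputable : ((ℕ → Alph) → ℕ → Alph) → Set
  GComputable ζ = Σ CSet λ X → Infinite X × (∀ v → v ∈ᶜ X → v ∈ᶜ G) ×
                  Σ Machine λ M → ComputableMachine M × ComputableVia ζ X M

  -- standard coding of finitely supported functions ℕ → 𝔄 by naturals:
  -- decode n v = v-th base-(2+a) digit of n
  decode : ℕ → ℕ → Alph
  decode n zero = n mod suc (suc a)
  decode n (suc v) = decode (n / suc (suc a)) v

  ComputableFn : CSet → ((ℕ → Alph) → ℕ → Alph) → Set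
  ComputableFn X ζ =
    ComputableOn 2 (λ { (n ∷ v ∷ []) → v ∈ᶜ X })
                   (λ { (n ∷ v ∷ []) → toℕ (ζ (restrict X (decode n)) v) })

-- Let M be a computable 𝒢-machine computing ζ.  Since every vertex
-- has exactly d neighbours and adjacency is decidable, the neighbours of v
-- can be found effectively: they all lie below the least B such that d of
-- them lie below B.  Hence the configuration of v at stage m of a run only
-- depends on the vertices below a computable bound, and is computed by
-- simulating finitely many vertices for m steps.  Outside the support of
-- the input a vertex stays at rest until some neighbour emits a color, so
-- whether the run halts at stage m is decidable as well; minimisation finds
-- the halting stage, and ζ x v is the symbol displayed by v there.
module Submission where

open import Defs
open import Data.Nat using (ℕ; zero; suc; _+_; _*_; _∸_; _≤_; _<_; z≤n; s≤s; s≤s⁻¹; _^_; _/_; _%_; _≟_; _<?_; pred; >-nonZero)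
open import Data.Nat.Properties
open import Data.Nat.DivMod using (_mod_; m%n<n; m≡m%n+[m/n]*n; m/n*n≤m; m%n≡m∸m/n*n; [m+kn]%n≡m%n; m<n⇒m%n≡m; +-distrib-/; m<n⇒m/n≡0; m*n/n≡m; m*n%n≡0; m/n<m; m%n%n≡m%n; 0/n≡0)
open import Data.Nat.Induction using (<-rec)
open import Data.Nat.ListAction using (sum)
open import Data.Fin using (Fin; toℕ) renaming (zero to fzero; suc to fsuc)
open import Data.Fin.Properties using (toℕ-fromℕ<; toℕ-injective; toℕ<n)
open import Data.Vec using (Vec; []; _∷_)
open import Data.Bool using (true; false)
open import Data.List using (List; []; _∷_; length)
open import Data.List.Membership.Propositional using (_∈_)
open import Data.List.Relation.Unary.All as All using (All; []; _∷_)
open import Data.List.Relation.Unary.AllPairs using (_∷_)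
open import Data.List.Relation.Unary.Any using (here; there)
open import Data.List.Relation.Unary.Unique.Propositional using (Unique)
open import Data.Empty using (⊥)
open import Data.Product using (Σ; _×_; _,_; proj₁; proj₂)
open import Data.Sum using (_⊎_; inj₁; inj₂)
open import Function.Bundles using (Equivalence)
open import Relation.Binary.Definitions using (tri<; tri≈; tri>)
open import Relation.Binary.PropositionalEquality
open import Relation.Nullary using (¬_; Dec; yes; no; contradiction)
open import Relation.Nullary.Decidable using (map′)

computable-ext : ∀ {n f g} → Computable n f → (∀ xs → f xs ≡ g xs) → Computable n g
computable-ext (c , ok) f≗g = c , λ xs → subst (c ⟨ xs ⟩⇓_) (f≗g xs) (ok xs)

-- Naming: fᶜ is a proof that f is computable.  The basic functions:
zeroᶜ : ∀ {n} → Computable n (λ _ → 0)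
zeroᶜ = zeroF , λ _ → ev-zero

projᶜ : ∀ {n} (i : Fin n) → Computable n (λ xs → lookupV xs i)
projᶜ i = proj i , λ _ → ev-proj i

v0 : ∀ {n} → Vec ℕ (suc n) → ℕ
v0 (x ∷ _) = x
v1 : ∀ {n} → Vec ℕ (suc (suc n)) → ℕ
v1 (_ ∷ y ∷ _) = y
v2 : ∀ {n} → Vec ℕ (suc (suc (suc n))) → ℕ
v2 (_ ∷ _ ∷ z ∷ _) = z
v3 : ∀ {n} → Vec ℕ (suc (suc (suc (suc n)))) → ℕ
v3 (_ ∷ _ ∷ _ ∷ w ∷ _) = w
v4 : ∀ {n} → Vec ℕ (suc (suc (suc (suc (suc n))))) → ℕ
v4 (_ ∷ _ ∷ _ ∷ _ ∷ u ∷ _) = u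

tl : ∀ {n} → Vec ℕ (suc n) → Vec ℕ n
tl (_ ∷ xs) = xs

arg0ᶜ : ∀ {n} → Computable (suc n) v0
arg0ᶜ = computable-ext (projᶜ fzero) λ { (_ ∷ _) → refl }
arg1ᶜ : ∀ {n} → Computable (suc (suc n)) v1
arg1ᶜ = computable-ext (projᶜ (fsuc fzero)) λ { (_ ∷ _ ∷ _) → refl }
arg2ᶜ : ∀ {n} → Computable (suc (suc (suc n))) v2
arg2ᶜ = computable-ext (projᶜ (fsuc (fsuc fzero))) λ { (_ ∷ _ ∷ _ ∷ _) → refl }
arg3ᶜ : ∀ {n} → Computable (suc (suc (suc (suc n)))) v3
arg3ᶜ = computable-ext (projᶜ (fsuc (fsuc (fsuc fzero)))) λ { (_ ∷ _ ∷ _ ∷ _ ∷ _) → refl }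
arg4ᶜ : ∀ {n} → Computable (suc (suc (suc (suc (suc n))))) v4
arg4ᶜ = computable-ext (projᶜ (fsuc (fsuc (fsuc (fsuc fzero))))) λ { (_ ∷ _ ∷ _ ∷ _ ∷ _ ∷ _) → refl }

sucᶜ : Computable 1 (λ xs → suc (v0 xs))
sucᶜ = succF , λ { (x ∷ []) → ev-succ }

data Computables (n : ℕ) : (m : ℕ) → (Vec ℕ n → Vec ℕ m) → Set where
  []  : Computables n 0 (λ _ → [])
  _∷_ : ∀ {m g gs} → Computable n g → Computables n m gs →
        Computables n (suc m) (λ xs → g xs ∷ gs xs)

codes : ∀ {n m gs} → Computables n m gs → Vec (PR n) m
codes [] = []
codes ((c , _) ∷ cs) = c ∷ codes cs

codes-eval : ∀ {n m gs} (cs : Computables n m gs) xs → codes cs ⟪ xs ⟫⇓ gs xs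
codes-eval [] xs = evs-[]
codes-eval ((c , ok) ∷ cs) xs = evs-∷ (ok xs) (codes-eval cs xs)

composeOn : ∀ {n m D F gs} → ComputableOn m D F → Computables n m gs →
            (∀ xs → D (gs xs)) → Computable n (λ xs → F (gs xs))
composeOn (c , ok) cs inD = comp c (codes cs) , λ xs → ev-comp (codes-eval cs xs) (ok _ (inD xs))

infixr 9 _∘ᶜ_
_∘ᶜ_ : ∀ {n m F gs} → Computable m F → Computables n m gs → Computable n (λ xs → F (gs xs))
(c , ok) ∘ᶜ cs = comp c (codes cs) , λ xs → ev-comp (codes-eval cs xs) (ok _)

constᶜ : ∀ {n} k → Computable n (λ _ → k)
constᶜ zero = zeroᶜ
constᶜ (suc k) = sucᶜ ∘ᶜ (constᶜ k ∷ [])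

primRec : ∀ {n} → (Vec ℕ n → ℕ) → (Vec ℕ (suc (suc n)) → ℕ) → Vec ℕ (suc n) → ℕ
primRec g h (zero ∷ xs) = g xs
primRec g h (suc k ∷ xs) = h (k ∷ primRec g h (k ∷ xs) ∷ xs)

primRecᶜ : ∀ {n g h} → Computable n g → Computable (suc (suc n)) h →
           Computable (suc n) (primRec g h)
primRecᶜ {n} {g} {h} (cg , okg) (ch , okh) = prim cg ch , eval
  where
  eval : (xs : Vec ℕ (suc n)) → prim cg ch ⟨ xs ⟩⇓ primRec g h xs
  eval (zero ∷ xs) = ev-prim0 (okg xs)
  eval (suc k ∷ xs) = ev-primS (eval (k ∷ xs)) (okh _)

IsLeastZero : (ℕ → ℕ) → ℕ → Set
IsLeastZero P m = P m ≡ 0 × (∀ i → i < m → 0 < P i)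

leastZero : (P : ℕ → ℕ) → ∀ y → P y ≡ 0 → Σ ℕ (IsLeastZero P)
leastZero P zero py = 0 , py , λ _ ()
leastZero P (suc y) py with P 0 ≟ 0
... | yes p0 = 0 , p0 , λ _ ()
... | no p0≢0 with leastZero (λ i → P (suc i)) y py
...   | m , pm , below = suc m , pm , λ { zero _ → n≢0⇒n>0 p0≢0 ; (suc i) i<m → below i (s≤s⁻¹ i<m) }

leastZero-unique : ∀ {P m m'} → IsLeastZero P m → IsLeastZero P m' → m ≡ m'
leastZero-unique {m = m} {m'} (pm , below) (pm' , below') with <-cmp m m'
... | tri≈ _ m≡m' _ = m≡m'
... | tri< m<m' _ _ = contradiction (subst (0 <_) pm (below' m m<m')) (<-irrefl refl)
... | tri> _ _ m'<m = contradiction (subst (0 <_) pm' (below m' m'<m)) (<-irrefl refl)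

minimiseᶜ : ∀ {n} {P : Vec ℕ (suc n) → ℕ} → Computable (suc n) P → (f : Vec ℕ n → ℕ) →
            (∀ xs → IsLeastZero (λ i → P (i ∷ xs)) (f xs)) → Computable n f
minimiseᶜ {P = P} (c , ok) f least = mu c , λ xs →
  ev-mu (subst (c ⟨ f xs ∷ xs ⟩⇓_) (proj₁ (least xs)) (ok _))
        (λ i i< → pred (P (i ∷ xs)) ,
           subst (c ⟨ i ∷ xs ⟩⇓_) (sym (suc-pred (P (i ∷ xs)) ⦃ >-nonZero (proj₂ (least xs) i i<) ⦄)) (ok _))

tab : ∀ {m} → (Fin m → ℕ) → Vec ℕ m
tab {zero} f = []
tab {suc m} f = f fzero ∷ tab (λ j → f (fsuc j))

tab-lookup : ∀ {m} (xs : Vec ℕ m) → tab (lookupV xs) ≡ xs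
tab-lookup [] = refl
tab-lookup (x ∷ xs) = cong (x ∷_) (tab-lookup xs)

selectᶜ : ∀ {n m} (ρ : Fin m → Fin n) → Computables n m (λ xs → tab (λ j → lookupV xs (ρ j)))
selectᶜ {m = zero} ρ = []
selectᶜ {m = suc m} ρ = projᶜ (ρ fzero) ∷ selectᶜ (λ j → ρ (fsuc j))

skipSecondᶜ : ∀ {n} {F : Vec ℕ (suc n) → ℕ} → Computable (suc n) F →
              Computable (suc (suc n)) (λ xs → F (v0 xs ∷ tl (tl xs)))
skipSecondᶜ {F = F} cF = computable-ext (cF ∘ᶜ (arg0ᶜ ∷ selectᶜ (λ j → fsuc (fsuc j))))
  λ { (k ∷ _ ∷ xs) → cong (λ ys → F (k ∷ ys)) (tab-lookup xs) }

addᶜ : Computable 2 (λ xs → v0 xs + v1 xs)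
addᶜ = computable-ext (primRecᶜ (arg0ᶜ) (sucᶜ ∘ᶜ (arg1ᶜ ∷ []))) spec
  where
  spec : ∀ xs → _ ≡ v0 xs + v1 xs
  spec (zero ∷ y ∷ []) = refl
  spec (suc x ∷ y ∷ []) = cong suc (spec (x ∷ y ∷ []))

mulᶜ : Computable 2 (λ xs → v0 xs * v1 xs)
mulᶜ = computable-ext (primRecᶜ zeroᶜ (addᶜ ∘ᶜ (arg2ᶜ ∷ arg1ᶜ ∷ []))) spec
  where
  spec : ∀ xs → _ ≡ v0 xs * v1 xs
  spec (zero ∷ y ∷ []) = refl
  spec (suc x ∷ y ∷ []) = cong (y +_) (spec (x ∷ y ∷ []))

predᶜ : Computable 1 (λ xs → pred (v0 xs))
predᶜ = computable-ext (primRecᶜ zeroᶜ (arg0ᶜ)) λ { (zero ∷ []) → refl ; (suc x ∷ []) → refl }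

monusᶜ : Computable 2 (λ xs → v0 xs ∸ v1 xs)
monusᶜ = computable-ext (flipped ∘ᶜ (arg1ᶜ ∷ arg0ᶜ ∷ [])) λ { (x ∷ y ∷ []) → refl }
  where
  flipped : Computable 2 (λ xs → v1 xs ∸ v0 xs)
  flipped = computable-ext (primRecᶜ (arg0ᶜ) (predᶜ ∘ᶜ (arg1ᶜ ∷ []))) spec
    where
    spec : ∀ xs → _ ≡ v1 xs ∸ v0 xs
    spec (zero ∷ y ∷ []) = refl
    spec (suc x ∷ y ∷ []) = trans (cong pred (spec (x ∷ y ∷ []))) (pred[m∸n]≡m∸[1+n] y x)

sg : ℕ → ℕ
sg zero = 0
sg (suc _) = 1

sgᶜ : Computable 1 (λ xs → sg (v0 xs))
sgᶜ = computable-ext (primRecᶜ zeroᶜ (constᶜ 1)) λ { (zero ∷ []) → refl ; (suc x ∷ []) → refl }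

ifz : ℕ → ℕ → ℕ → ℕ
ifz zero x y = y
ifz (suc _) x y = x

ifzᶜ : Computable 3 (λ xs → ifz (v0 xs) (v1 xs) (v2 xs))
ifzᶜ = computable-ext (primRecᶜ (arg1ᶜ) (arg2ᶜ))
  λ { (zero ∷ x ∷ y ∷ []) → refl ; (suc b ∷ x ∷ y ∷ []) → refl }

pow2ᶜ : Computable 1 (λ xs → 2 ^ v0 xs)
pow2ᶜ = computable-ext (primRecᶜ (constᶜ 1) (mulᶜ ∘ᶜ (constᶜ 2 ∷ arg1ᶜ ∷ []))) spec
  where
  spec : ∀ xs → _ ≡ 2 ^ v0 xs
  spec (zero ∷ []) = refl
  spec (suc e ∷ []) = cong (2 *_) (spec (e ∷ []))

dist : ℕ → ℕ → ℕ
dist x y = (x ∸ y) + (y ∸ x)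

distᶜ : Computable 2 (λ xs → dist (v0 xs) (v1 xs))
distᶜ = addᶜ ∘ᶜ (monusᶜ ∘ᶜ (arg0ᶜ ∷ arg1ᶜ ∷ []) ∷ monusᶜ ∘ᶜ (arg1ᶜ ∷ arg0ᶜ ∷ []) ∷ [])

dist-refl : ∀ x → dist x x ≡ 0
dist-refl x = cong₂ _+_ (n∸n≡0 x) (n∸n≡0 x)

dist≡0 : ∀ x y → dist x y ≡ 0 → x ≡ y
dist≡0 x y d≡0 = ≤-antisym (m∸n≡0⇒m≤n (m+n≡0⇒m≡0 (x ∸ y) d≡0)) (m∸n≡0⇒m≤n (m+n≡0⇒n≡0 (x ∸ y) d≡0))

sumBelow : (ℕ → ℕ) → ℕ → ℕ
sumBelow f zero = 0
sumBelow f (suc k) = sumBelow f k + f k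

withBoundᶜ : ∀ {n} (Φ : (ℕ → ℕ) → ℕ → ℕ) {F : Vec ℕ (suc n) → ℕ} {B : Vec ℕ n → ℕ} →
             Computable (suc n) (λ xs → Φ (λ i → F (i ∷ tl xs)) (v0 xs)) → Computable n B →
             Computable n (λ xs → Φ (λ i → F (i ∷ xs)) (B xs))
withBoundᶜ Φ {F} {B} Φᶜ Bᶜ = computable-ext (Φᶜ ∘ᶜ (Bᶜ ∷ selectᶜ (λ j → j)))
  λ xs → cong (λ ys → Φ (λ i → F (i ∷ ys)) (B xs)) (tab-lookup xs)

sumᶜ : ∀ {n} {F : Vec ℕ (suc n) → ℕ} {B : Vec ℕ n → ℕ} → Computable (suc n) F → Computable n B →
       Computable n (λ xs → sumBelow (λ i → F (i ∷ xs)) (B xs))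
sumᶜ {n} {F} Fᶜ = withBoundᶜ sumBelow {F} runningᶜ
  where
  runningᶜ : Computable (suc n) (λ xs → sumBelow (λ i → F (i ∷ tl xs)) (v0 xs))
  runningᶜ = computable-ext (primRecᶜ zeroᶜ (addᶜ ∘ᶜ (arg1ᶜ ∷ skipSecondᶜ Fᶜ ∷ []))) spec
    where
    spec : ∀ xs → _ ≡ sumBelow (λ i → F (i ∷ tl xs)) (v0 xs)
    spec (zero ∷ xs) = refl
    spec (suc k ∷ xs) = cong (_+ F (k ∷ xs)) (spec (k ∷ xs))

sumBelow-cong : ∀ {f g} → (∀ i → f i ≡ g i) → ∀ B → sumBelow f B ≡ sumBelow g B
sumBelow-cong f≗g zero = refl
sumBelow-cong f≗g (suc B) = cong₂ _+_ (sumBelow-cong f≗g B) (f≗g B)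

sumBelow-first : ∀ f B → sumBelow f (suc B) ≡ f 0 + sumBelow (λ i → f (suc i)) B
sumBelow-first f zero = +-comm 0 (f 0)
sumBelow-first f (suc B) = trans (cong (_+ f (suc B)) (sumBelow-first f B)) (+-assoc (f 0) _ (f (suc B)))

sumBelow-*2 : ∀ f B → sumBelow (λ i → f i * 2) B ≡ sumBelow f B * 2
sumBelow-*2 f zero = refl
sumBelow-*2 f (suc B) = trans (cong (_+ f B * 2) (sumBelow-*2 f B)) (sym (*-distribʳ-+ 2 (sumBelow f B) (f B)))

sumBelow-≥ : ∀ f B u → u < B → f u ≤ sumBelow f B
sumBelow-≥ f (suc B) u u<1+B with m≤n⇒m<n∨m≡n (s≤s⁻¹ u<1+B)
... | inj₁ u<B = ≤-trans (sumBelow-≥ f B u u<B) (m≤m+n _ _)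
... | inj₂ refl = m≤n+m _ _

sumBelow-mono : ∀ f {B B'} → B ≤ B' → sumBelow f B ≤ sumBelow f B'
sumBelow-mono f {B' = zero} z≤n = ≤-refl
sumBelow-mono f {B} {suc B'} B≤1+B' with m≤n⇒m<n∨m≡n B≤1+B'
... | inj₁ B<1+B' = ≤-trans (sumBelow-mono f (s≤s⁻¹ B<1+B')) (m≤m+n _ _)
... | inj₂ refl = ≤-refl

sumBelow-zero : ∀ f B → (∀ u → u < B → f u ≡ 0) → sumBelow f B ≡ 0
sumBelow-zero f zero _ = refl
sumBelow-zero f (suc B) f≡0 = cong₂ _+_ (sumBelow-zero f B (λ u u<B → f≡0 u (m<n⇒m<1+n u<B))) (f≡0 B ≤-refl)

sumBelow-zero⁻¹ : ∀ f B u → u < B → sumBelow f B ≡ 0 → f u ≡ 0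
sumBelow-zero⁻¹ f B u u<B sum≡0 = n≤0⇒n≡0 (subst (f u ≤_) sum≡0 (sumBelow-≥ f B u u<B))

sumBelow-positive : ∀ f B → 0 < sumBelow f B → Σ ℕ λ u → u < B × 0 < f u
sumBelow-positive f (suc B) pos with f B in fB
... | suc _ = B , ≤-refl , subst (0 <_) (sym fB) (s≤s z≤n)
... | zero with sumBelow-positive f B (subst (0 <_) (+-identityʳ _) pos)
...   | u , u<B , fu>0 = u , m<n⇒m<1+n u<B , fu>0

-- Division and remainder by a fixed positive divisor; the quotient is the
-- least q with x < (q + 1) · D.
divᶜ : ∀ d → Computable 1 (λ xs → v0 xs / suc d)
divᶜ d = minimiseᶜ overshoot (λ xs → v0 xs / D) λ { (x ∷ []) → quotient-least x }
  where
  D = suc d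
  overshoot : Computable 2 (λ xs → suc (v1 xs) ∸ suc (v0 xs) * D)
  overshoot = monusᶜ ∘ᶜ (sucᶜ ∘ᶜ (arg1ᶜ ∷ []) ∷ mulᶜ ∘ᶜ (sucᶜ ∘ᶜ (arg0ᶜ ∷ []) ∷ constᶜ D ∷ []) ∷ [])
  quotient-least : ∀ x → IsLeastZero (λ q → suc x ∸ suc q * D) (x / D)
  quotient-least x = m≤n⇒m∸n≡0 x<next , λ q q< → m<n⇒0<n∸m (s≤s (q+1≤ q q<))
    where
    open ≤-Reasoning
    x<next : x < D + (x / D) * D
    x<next = begin-strict
      x                    ≡⟨ m≡m%n+[m/n]*n x D ⟩
      x % D + (x / D) * D  <⟨ +-monoˡ-< ((x / D) * D) (m%n<n x D) ⟩
      D + (x / D) * D      ∎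
    q+1≤ : ∀ q → q < x / D → suc q * D ≤ x
    q+1≤ q q< = begin
      suc q * D    ≤⟨ *-monoˡ-≤ D q< ⟩
      (x / D) * D  ≤⟨ m/n*n≤m x D ⟩
      x            ∎

modᶜ : ∀ d → Computable 1 (λ xs → v0 xs % suc d)
modᶜ d = computable-ext (monusᶜ ∘ᶜ (arg0ᶜ ∷ mulᶜ ∘ᶜ (divᶜ d ∷ constᶜ (suc d) ∷ []) ∷ []))
  λ { (x ∷ []) → sym (m%n≡m∸m/n*n x (suc d)) }

shiftDown : ℕ → ℕ → ℕ → ℕ
shiftDown d zero s = s
shiftDown d (suc i) s = shiftDown d i s / suc d

shiftDownᶜ : ∀ d → Computable 2 (λ xs → shiftDown d (v0 xs) (v1 xs))
shiftDownᶜ d = computable-ext (primRecᶜ (arg0ᶜ) (divᶜ d ∘ᶜ (arg1ᶜ ∷ []))) spec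
  where
  spec : ∀ xs → _ ≡ shiftDown d (v0 xs) (v1 xs)
  spec (zero ∷ s ∷ []) = refl
  spec (suc i ∷ s ∷ []) = cong (_/ suc d) (spec (i ∷ s ∷ []))

shiftDown-suc : ∀ d i s → shiftDown d (suc i) s ≡ shiftDown d i (s / suc d)
shiftDown-suc d zero s = refl
shiftDown-suc d (suc i) s = cong (_/ suc d) (shiftDown-suc d i s)

digit : ℕ → ℕ → ℕ → ℕ
digit d s i = shiftDown d i s % suc d

digitᶜ : ∀ d → Computable 2 (λ xs → digit d (v0 xs) (v1 xs))
digitᶜ d = modᶜ d ∘ᶜ (shiftDownᶜ d ∘ᶜ (arg1ᶜ ∷ arg0ᶜ ∷ []) ∷ [])

≤1-cases : ∀ {x} → x ≤ 1 → x ≡ 0 ⊎ x ≡ 1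
≤1-cases z≤n = inj₁ refl
≤1-cases (s≤s z≤n) = inj₂ refl

≤1-equal : ∀ {x y} → x ≤ 1 → y ≤ 1 → (x ≡ 1 → y ≡ 1) → (y ≡ 1 → x ≡ 1) → x ≡ y
≤1-equal x≤1 y≤1 x⇒y y⇒x with ≤1-cases x≤1 | ≤1-cases y≤1
... | inj₁ x≡0 | inj₁ y≡0 = trans x≡0 (sym y≡0)
... | inj₁ x≡0 | inj₂ y≡1 = trans (y⇒x y≡1) (sym y≡1)
... | inj₂ x≡1 | _ = trans x≡1 (sym (x⇒y x≡1))

≤1-positive : ∀ {x} → x ≤ 1 → 0 < x → x ≡ 1
≤1-positive (s≤s z≤n) _ = refl

*-≤1 : ∀ {x y} → x ≤ 1 → y ≤ 1 → x * y ≤ 1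
*-≤1 z≤n _ = z≤n
*-≤1 (s≤s z≤n) y≤1 = subst (_≤ 1) (sym (+-identityʳ _)) y≤1

*-positive : ∀ x y → 0 < x * y → 0 < x × 0 < y
*-positive (suc x) (suc y) _ = s≤s z≤n , s≤s z≤n
*-positive (suc x) zero p = contradiction (subst (0 <_) (*-zeroʳ x) p) (<-irrefl refl)

sg≤1 : ∀ x → sg x ≤ 1
sg≤1 zero = z≤n
sg≤1 (suc x) = s≤s z≤n

sg-positive : ∀ {x} → 0 < x → sg x ≡ 1
sg-positive {suc x} _ = refl

sg≡1 : ∀ x → sg x ≡ 1 → 0 < x
sg≡1 (suc x) _ = s≤s z≤n

χ : CSet → ℕ → ℕ
χ A i = bool→ℕ (CSet.χ A i)

χᶜ : (A : CSet) → Computable 1 (λ xs → χ A (v0 xs))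
χᶜ A = computable-ext (CSet.χ-comp A) λ { (x ∷ []) → refl }

χ≤1 : ∀ A i → χ A i ≤ 1
χ≤1 A i with CSet.χ A i
... | true = s≤s z≤n
... | false = z≤n

χ-positive : ∀ A i → 0 < χ A i → i ∈ᶜ A
χ-positive A i p with CSet.χ A i
... | true = refl

χ-member : ∀ A i → i ∈ᶜ A → χ A i ≡ 1
χ-member A i i∈A = cong bool→ℕ i∈A

χ-cases : ∀ A i → i ∈ᶜ A ⊎ χ A i ≡ 0
χ-cases A i with CSet.χ A i
... | true = inj₁ refl
... | false = inj₂ refl

χ-∈-* : ∀ A i x → i ∈ᶜ A → χ A i * x ≡ x
χ-∈-* A i x i∈A = trans (cong (_* x) (χ-member A i i∈A)) (*-identityˡ x)

halves : ∀ s → s ≡ bit s 0 + (s / 2) * 2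
halves s = m≡m%n+[m/n]*n s 2

bit-cons : ∀ b e → b ≤ 1 → bit (b + e * 2) 0 ≡ b
bit-cons b e b≤1 = trans ([m+kn]%n≡m%n b e 2) (m<n⇒m%n≡m (s≤s b≤1))

half-cons : ∀ b e → b ≤ 1 → (b + e * 2) / 2 ≡ e
half-cons b e b≤1 = begin
    (b + e * 2) / 2    ≡⟨ +-distrib-/ b (e * 2) no-carry ⟩
    b / 2 + e * 2 / 2  ≡⟨ cong₂ _+_ (m<n⇒m/n≡0 (s≤s b≤1)) (m*n/n≡m e 2) ⟩
    e                  ∎
  where
  open ≡-Reasoning
  no-carry : b % 2 + (e * 2) % 2 < 2
  no-carry = subst (λ r → b % 2 + r < 2) (sym (m*n%n≡0 e 2))
               (subst (_< 2) (sym (+-identityʳ (b % 2))) (m%n<n b 2))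

bit-shiftDown : ∀ i s → bit s i ≡ digit 1 s i
bit-shiftDown zero s = refl
bit-shiftDown (suc i) s = trans (bit-shiftDown i (s / 2)) (cong (_% 2) (sym (shiftDown-suc 1 i s)))

bitᶜ : Computable 2 (λ xs → bit (v0 xs) (v1 xs))
bitᶜ = computable-ext (digitᶜ 1) λ { (s ∷ i ∷ []) → sym (bit-shiftDown i s) }

bit≤1 : ∀ s i → bit s i ≤ 1
bit≤1 s zero = s≤s⁻¹ (m%n<n s 2)
bit≤1 s (suc i) = bit≤1 (s / 2) i

bit-of-0 : ∀ i → bit 0 i ≡ 0
bit-of-0 zero = refl
bit-of-0 (suc i) = bit-of-0 i

∈ₛ⇒≢∅ : ∀ s i → i ∈ₛ s → s ≢ ∅ₛ
∈ₛ⇒≢∅ s i i∈s refl = 0≢1+n (trans (sym (bit-of-0 i)) i∈s)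

∈ₛ⇒< : ∀ s i → i ∈ₛ s → i < s
∈ₛ⇒< zero i i∈s = contradiction refl (∈ₛ⇒≢∅ 0 i i∈s)
∈ₛ⇒< (suc s) zero _ = s≤s z≤n
∈ₛ⇒< (suc s) (suc i) i∈s = <-≤-trans (s≤s (∈ₛ⇒< (suc s / 2) i i∈s)) (m/n<m (suc s) 2 (s≤s (s≤s z≤n)))

nonempty-member : ∀ s → s ≢ ∅ₛ → Σ ℕ (_∈ₛ s)
nonempty-member = <-rec _ step
  where
  step : ∀ s → (∀ {t} → t < s → t ≢ ∅ₛ → Σ ℕ (_∈ₛ t)) → s ≢ ∅ₛ → Σ ℕ (_∈ₛ s)
  step zero _ s≢∅ = contradiction refl s≢∅
  step (suc s) rec _ with ≤1-cases (bit≤1 (suc s) 0)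
  ... | inj₂ 0∈s = 0 , 0∈s
  ... | inj₁ 0∉s with rec (m/n<m (suc s) 2 (s≤s (s≤s z≤n))) half≢0
    where
    half≢0 : suc s / 2 ≢ 0
    half≢0 h = 0≢1+n (sym (trans (halves (suc s)) (cong₂ (λ b q → b + q * 2) 0∉s h)))
  ...   | i , i∈half = suc i , i∈half

bit-ext : ∀ s t → (∀ i → bit s i ≡ bit t i) → s ≡ t
bit-ext = <-rec _ step
  where
  empty : ∀ t → (∀ i → bit t i ≡ 0) → t ≡ 0
  empty t t-empty with t ≟ 0
  ... | yes t≡0 = t≡0
  ... | no t≢0 with nonempty-member t t≢0
  ...   | i , i∈t = contradiction (trans (sym (t-empty i)) i∈t) 0≢1+n
  step : ∀ s → (∀ {s'} → s' < s → ∀ t → (∀ i → bit s' i ≡ bit t i) → s' ≡ t) →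
         ∀ t → (∀ i → bit s i ≡ bit t i) → s ≡ t
  step zero _ t same = sym (empty t λ i → trans (sym (same i)) (bit-of-0 i))
  step (suc s) rec t same = begin
      suc s                            ≡⟨ halves (suc s) ⟩
      bit (suc s) 0 + (suc s / 2) * 2  ≡⟨ cong₂ (λ b q → b + q * 2) (same 0) halves-equal ⟩
      bit t 0 + (t / 2) * 2            ≡⟨ sym (halves t) ⟩
      t                                ∎
    where
    open ≡-Reasoning
    halves-equal : suc s / 2 ≡ t / 2
    halves-equal = rec (m/n<m (suc s) 2 (s≤s (s≤s z≤n))) (t / 2) (λ i → same (suc i))

finset-ext : ∀ s t → (∀ i → i ∈ₛ s → i ∈ₛ t) → (∀ i → i ∈ₛ t → i ∈ₛ s) → s ≡ t
finset-ext s t s⊆t t⊆s = bit-ext s t λ i → ≤1-equal (bit≤1 s i) (bit≤1 t i) (s⊆t i) (t⊆s i)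

fromBits : (ℕ → ℕ) → ℕ → FinSet
fromBits β zero = 0
fromBits β (suc B) = β 0 + fromBits (λ i → β (suc i)) B * 2

Bits : (ℕ → ℕ) → Set
Bits β = ∀ i → β i ≤ 1

bit-fromBits-< : ∀ β → Bits β → ∀ B j → j < B → bit (fromBits β B) j ≡ β j
bit-fromBits-< β β01 (suc B) zero _ = bit-cons (β 0) (fromBits (λ i → β (suc i)) B) (β01 0)
bit-fromBits-< β β01 (suc B) (suc j) (s≤s j<B) =
  trans (cong (λ s → bit s j) (half-cons (β 0) (fromBits (λ i → β (suc i)) B) (β01 0)))
        (bit-fromBits-< (λ i → β (suc i)) (λ i → β01 (suc i)) B j j<B)

bit-fromBits-≥ : ∀ β → Bits β → ∀ B j → B ≤ j → bit (fromBits β B) j ≡ 0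
bit-fromBits-≥ β β01 zero j _ = bit-of-0 j
bit-fromBits-≥ β β01 (suc B) (suc j) (s≤s B≤j) =
  trans (cong (λ s → bit s j) (half-cons (β 0) (fromBits (λ i → β (suc i)) B) (β01 0)))
        (bit-fromBits-≥ (λ i → β (suc i)) (λ i → β01 (suc i)) B j B≤j)

∈-fromBits : ∀ β → Bits β → ∀ B j → j ∈ₛ fromBits β B → j < B × β j ≡ 1
∈-fromBits β β01 B j j∈ with <-cmp j B
... | tri< j<B _ _ = j<B , trans (sym (bit-fromBits-< β β01 B j j<B)) j∈
... | tri≈ _ j≡B _ = contradiction (trans (sym (bit-fromBits-≥ β β01 B j (≤-reflexive (sym j≡B)))) j∈) 0≢1+n
... | tri> _ _ B<j = contradiction (trans (sym (bit-fromBits-≥ β β01 B j (<⇒≤ B<j))) j∈) 0≢1+n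

-- fromBits as a bounded sum, which exhibits its computability.
fromBits-sum : ∀ β B → sumBelow (λ i → 2 ^ i * β i) B ≡ fromBits β B
fromBits-sum β zero = refl
fromBits-sum β (suc B) = begin
    sumBelow (λ i → 2 ^ i * β i) (suc B)
      ≡⟨ sumBelow-first (λ i → 2 ^ i * β i) B ⟩
    1 * β 0 + sumBelow (λ i → 2 ^ suc i * β (suc i)) B
      ≡⟨ cong₂ _+_ (*-identityˡ (β 0)) (sumBelow-cong double B) ⟩
    β 0 + sumBelow (λ i → (2 ^ i * β (suc i)) * 2) B
      ≡⟨ cong (β 0 +_) (sumBelow-*2 (λ i → 2 ^ i * β (suc i)) B) ⟩
    β 0 + sumBelow (λ i → 2 ^ i * β (suc i)) B * 2
      ≡⟨ cong (λ r → β 0 + r * 2) (fromBits-sum (λ i → β (suc i)) B) ⟩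
    fromBits β (suc B) ∎
  where
  open ≡-Reasoning
  double : ∀ i → 2 ^ suc i * β (suc i) ≡ (2 ^ i * β (suc i)) * 2
  double i = trans (*-assoc 2 (2 ^ i) (β (suc i))) (*-comm 2 (2 ^ i * β (suc i)))

fromBitsᶜ : ∀ {n} {β : Vec ℕ (suc n) → ℕ} {B : Vec ℕ n → ℕ} → Computable (suc n) β → Computable n B →
            Computable n (λ xs → fromBits (λ i → β (i ∷ xs)) (B xs))
fromBitsᶜ {β = β} {B} βᶜ Bᶜ = computable-ext (sumᶜ (mulᶜ ∘ᶜ (pow2ᶜ ∘ᶜ (arg0ᶜ ∷ []) ∷ βᶜ ∷ [])) Bᶜ)
  λ xs → fromBits-sum (λ i → β (i ∷ xs)) (B xs)

_∩ᶜ_ : FinSet → CSet → FinSet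
s ∩ᶜ A = fromBits (λ i → bit s i * χ A i) s

∈-∩ᶜ : ∀ s A i → i ∈ₛ (s ∩ᶜ A) → i ∈ₛ s × i ∈ᶜ A
∈-∩ᶜ s A i i∈ with *-positive (bit s i) (χ A i) (subst (0 <_) (sym (proj₂ (∈-fromBits β β01 s i i∈))) (s≤s z≤n))
  where
  β = λ j → bit s j * χ A j
  β01 : Bits β
  β01 j = *-≤1 (bit≤1 s j) (χ≤1 A j)
... | in-s , in-A = ≤1-positive (bit≤1 s i) in-s , χ-positive A i in-A

∩ᶜ-⊆ : ∀ s A → (s ∩ᶜ A) ⊆ᶜ A
∩ᶜ-⊆ s A i i∈ = proj₂ (∈-∩ᶜ s A i i∈)

∩ᶜ-id : ∀ s A → s ⊆ᶜ A → s ∩ᶜ A ≡ s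
∩ᶜ-id s A s⊆A = finset-ext (s ∩ᶜ A) s (λ i i∈ → proj₁ (∈-∩ᶜ s A i i∈)) kept
  where
  kept : ∀ i → i ∈ₛ s → i ∈ₛ (s ∩ᶜ A)
  kept i i∈s = begin
      bit (s ∩ᶜ A) i   ≡⟨ bit-fromBits-< _ (λ j → *-≤1 (bit≤1 s j) (χ≤1 A j)) s i (∈ₛ⇒< s i i∈s) ⟩
      bit s i * χ A i  ≡⟨ cong₂ _*_ i∈s (χ-member A i (s⊆A i i∈s)) ⟩
      1                ∎
    where open ≡-Reasoning

∩ᶜᶜ : ∀ A → Computable 1 (λ xs → v0 xs ∩ᶜ A)
∩ᶜᶜ A = computable-ext (fromBitsᶜ (mulᶜ ∘ᶜ (bitᶜ ∘ᶜ (arg1ᶜ ∷ arg0ᶜ ∷ []) ∷ χᶜ A ∘ᶜ (arg0ᶜ ∷ []) ∷ [])) arg0ᶜ)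
  λ { (s ∷ []) → refl }

-- Redirecting arguments outside a computable set A to a default d ∈ A turns
-- functions computable on A into total computable functions.
into : CSet → ℕ → ℕ → ℕ
into A d v = ifz (χ A v) v d

intoᶜ : ∀ A d → Computable 1 (λ xs → into A d (v0 xs))
intoᶜ A d = ifzᶜ ∘ᶜ (χᶜ A ∷ arg0ᶜ ∷ constᶜ d ∷ [])

into-id : ∀ A d v → v ∈ᶜ A → into A d v ≡ v
into-id A d v v∈A rewrite v∈A = refl

into-∈ : ∀ A d v → d ∈ᶜ A → into A d v ∈ᶜ A
into-∈ A d v d∈A with CSet.χ A v in v∈?
... | true = v∈?
... | false = d∈A

-- The least element of a nonempty finite set s is the least zero of
-- i ↦ (1 ∸ bit s i) · (s ∸ i); the second factor makes the search total.
notLowest : FinSet → ℕ → ℕ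
notLowest s i = (1 ∸ bit s i) * (s ∸ i)

-- Kept abstract so that the search is never unfolded during type checking.
abstract
  lowest : FinSet → ℕ
  lowest s = proj₁ (leastZero (notLowest s) s (trans (cong ((1 ∸ bit s s) *_) (n∸n≡0 s)) (*-zeroʳ (1 ∸ bit s s))))

  lowest-least : ∀ s → IsLeastZero (notLowest s) (lowest s)
  lowest-least s = proj₂ (leastZero (notLowest s) s (trans (cong ((1 ∸ bit s s) *_) (n∸n≡0 s)) (*-zeroʳ (1 ∸ bit s s))))

lowestᶜ : Computable 1 (λ xs → lowest (v0 xs))
lowestᶜ = minimiseᶜ notLowestᶜ (λ xs → lowest (v0 xs)) λ { (s ∷ []) → lowest-least s }
  where
  notLowestᶜ : Computable 2 (λ xs → notLowest (v1 xs) (v0 xs))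
  notLowestᶜ = mulᶜ ∘ᶜ (monusᶜ ∘ᶜ (constᶜ 1 ∷ bitᶜ ∘ᶜ (arg1ᶜ ∷ arg0ᶜ ∷ []) ∷ []) ∷
                        monusᶜ ∘ᶜ (arg1ᶜ ∷ arg0ᶜ ∷ []) ∷ [])

-- Pairing: ⟨a , b⟩ = (2b + 1) · 2ᵃ, whose lowest bit is a and whose part
-- above that bit is b.
pair : ℕ → ℕ → ℕ
pair a b = (1 + b * 2) * 2 ^ a

unpair₁ unpair₂ : ℕ → ℕ
unpair₁ = lowest
unpair₂ z = shiftDown 1 (suc (lowest z)) z

pairᶜ : Computable 2 (λ xs → pair (v0 xs) (v1 xs))
pairᶜ = mulᶜ ∘ᶜ (sucᶜ ∘ᶜ (mulᶜ ∘ᶜ (arg1ᶜ ∷ constᶜ 2 ∷ []) ∷ []) ∷ pow2ᶜ ∘ᶜ (arg0ᶜ ∷ []) ∷ [])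

unpair₁ᶜ : Computable 1 (λ xs → unpair₁ (v0 xs))
unpair₁ᶜ = lowestᶜ

unpair₂ᶜ : Computable 1 (λ xs → unpair₂ (v0 xs))
unpair₂ᶜ = shiftDownᶜ 1 ∘ᶜ (sucᶜ ∘ᶜ (lowestᶜ ∷ []) ∷ arg0ᶜ ∷ [])

*2^-suc : ∀ m a → m * 2 ^ suc a ≡ 0 + (m * 2 ^ a) * 2
*2^-suc m a = trans (cong (m *_) (*-comm 2 (2 ^ a))) (sym (*-assoc m (2 ^ a) 2))

bit-*2^-below : ∀ m a i → i < a → bit (m * 2 ^ a) i ≡ 0
bit-*2^-below m (suc a) zero _ = trans (cong (λ s → bit s 0) (*2^-suc m a)) (bit-cons 0 (m * 2 ^ a) z≤n)
bit-*2^-below m (suc a) (suc i) (s≤s i<a) =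
  trans (cong (λ s → bit s (suc i)) (*2^-suc m a))
        (trans (cong (λ s → bit s i) (half-cons 0 (m * 2 ^ a) z≤n)) (bit-*2^-below m a i i<a))

bit-*2^-at : ∀ m a → bit (m * 2 ^ a) a ≡ bit m 0
bit-*2^-at m zero = cong (λ s → bit s 0) (*-identityʳ m)
bit-*2^-at m (suc a) =
  trans (cong (λ s → bit s (suc a)) (*2^-suc m a))
        (trans (cong (λ s → bit s a) (half-cons 0 (m * 2 ^ a) z≤n)) (bit-*2^-at m a))

shiftDown-*2^ : ∀ m a → shiftDown 1 a (m * 2 ^ a) ≡ m
shiftDown-*2^ m zero = *-identityʳ m
shiftDown-*2^ m (suc a) = trans (shiftDown-suc 1 a (m * 2 ^ suc a))
  (trans (cong (shiftDown 1 a) (trans (cong (_/ 2) (*2^-suc m a)) (half-cons 0 (m * 2 ^ a) z≤n)))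
         (shiftDown-*2^ m a))

unpair₁-pair : ∀ a b → unpair₁ (pair a b) ≡ a
unpair₁-pair a b = leastZero-unique (lowest-least z) (a-zero , below-positive)
  where
  z = pair a b
  a∈z : a ∈ₛ z
  a∈z = trans (bit-*2^-at (1 + b * 2) a) (bit-cons 1 b (s≤s z≤n))
  a-zero : notLowest z a ≡ 0
  a-zero = cong (λ x → (1 ∸ x) * (z ∸ a)) a∈z
  below-positive : ∀ i → i < a → 0 < notLowest z i
  below-positive i i<a = subst (λ x → 0 < (1 ∸ x) * (z ∸ i)) (sym (bit-*2^-below (1 + b * 2) a i i<a))
    (subst (0 <_) (sym (+-identityʳ (z ∸ i))) (m<n⇒0<n∸m (<-trans i<a (∈ₛ⇒< z a a∈z))))

unpair₂-pair : ∀ a b → unpair₂ (pair a b) ≡ b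
unpair₂-pair a b = begin
    shiftDown 1 (suc (lowest (pair a b))) (pair a b)  ≡⟨ cong (λ i → shiftDown 1 (suc i) (pair a b)) (unpair₁-pair a b) ⟩
    shiftDown 1 a (pair a b) / 2                     ≡⟨ cong (_/ 2) (shiftDown-*2^ (1 + b * 2) a) ⟩
    (1 + b * 2) / 2                                  ≡⟨ half-cons 1 b (s≤s z≤n) ⟩
    b                                                ∎
  where open ≡-Reasoning

pair-injective : ∀ {a b a' b'} → pair a b ≡ pair a' b' → a ≡ a' × b ≡ b'
pair-injective {a} {b} {a'} {b'} e =
  trans (sym (unpair₁-pair a b)) (trans (cong unpair₁ e) (unpair₁-pair a' b')) ,
  trans (sym (unpair₂-pair a b)) (trans (cong unpair₂ e) (unpair₂-pair a' b'))

-- Finite sequences: tuple f K codes f 0, …, f (K - 1) as nested pairs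
-- (last entry outermost), and entry L K u reads off entry u.
tuple : (ℕ → ℕ) → ℕ → ℕ
tuple f zero = 0
tuple f (suc K) = pair (f K) (tuple f K)

tupleᶜ : ∀ {n} {F : Vec ℕ (suc n) → ℕ} {K : Vec ℕ n → ℕ} → Computable (suc n) F → Computable n K →
         Computable n (λ xs → tuple (λ j → F (j ∷ xs)) (K xs))
tupleᶜ {n} {F} Fᶜ = withBoundᶜ tuple {F} runningᶜ
  where
  runningᶜ : Computable (suc n) (λ xs → tuple (λ j → F (j ∷ tl xs)) (v0 xs))
  runningᶜ = computable-ext (primRecᶜ zeroᶜ (pairᶜ ∘ᶜ (skipSecondᶜ Fᶜ ∷ arg1ᶜ ∷ []))) spec
    where
    spec : ∀ xs → _ ≡ tuple (λ j → F (j ∷ tl xs)) (v0 xs)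
    spec (zero ∷ xs) = refl
    spec (suc k ∷ xs) = cong (pair (F (k ∷ xs))) (spec (k ∷ xs))

drop : ℕ → ℕ → ℕ
drop zero L = L
drop (suc i) L = unpair₂ (drop i L)

drop-suc : ∀ i L → drop (suc i) L ≡ drop i (unpair₂ L)
drop-suc zero L = refl
drop-suc (suc i) L = cong unpair₂ (drop-suc i L)

dropᶜ : Computable 2 (λ xs → drop (v0 xs) (v1 xs))
dropᶜ = computable-ext (primRecᶜ arg0ᶜ (unpair₂ᶜ ∘ᶜ (arg1ᶜ ∷ []))) spec
  where
  spec : ∀ xs → _ ≡ drop (v0 xs) (v1 xs)
  spec (zero ∷ L ∷ []) = refl
  spec (suc i ∷ L ∷ []) = cong unpair₂ (spec (i ∷ L ∷ []))

entry : ℕ → ℕ → ℕ → ℕ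
entry L K u = unpair₁ (drop (K ∸ suc u) L)

entryᶜ : Computable 3 (λ xs → entry (v0 xs) (v1 xs) (v2 xs))
entryᶜ = unpair₁ᶜ ∘ᶜ (dropᶜ ∘ᶜ (monusᶜ ∘ᶜ (arg1ᶜ ∷ sucᶜ ∘ᶜ (arg2ᶜ ∷ []) ∷ []) ∷ arg0ᶜ ∷ []) ∷ [])

unpair₁-drop-tuple : ∀ f K i → i < K → unpair₁ (drop i (tuple f K)) ≡ f (K ∸ suc i)
unpair₁-drop-tuple f (suc K) zero _ = unpair₁-pair (f K) (tuple f K)
unpair₁-drop-tuple f (suc K) (suc i) (s≤s i<K) =
  trans (cong unpair₁ (trans (drop-suc i (tuple f (suc K))) (cong (drop i) (unpair₂-pair (f K) (tuple f K)))))
        (unpair₁-drop-tuple f K i i<K)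

entry-tuple : ∀ f K u → u < K → entry (tuple f K) K u ≡ f u
entry-tuple f (suc K) u (s≤s u≤K) =
  trans (unpair₁-drop-tuple f (suc K) (K ∸ u) (s≤s (m∸n≤m K u))) (cong f (m∸[m∸n]≡n u≤K))

ltb : ℕ → ℕ → ℕ
ltb x zero = 0
ltb zero (suc B) = 1
ltb (suc x) (suc B) = ltb x B

eqb : ℕ → ℕ → ℕ
eqb zero zero = 1
eqb zero (suc _) = 0
eqb (suc _) zero = 0
eqb (suc x) (suc y) = eqb x y

ltb-suc : ∀ x B → ltb x (suc B) ≡ ltb x B + eqb x B
ltb-suc zero zero = refl
ltb-suc zero (suc B) = refl
ltb-suc (suc x) zero = refl
ltb-suc (suc x) (suc B) = ltb-suc x B

eqb-refl : ∀ x → eqb x x ≡ 1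
eqb-refl zero = refl
eqb-refl (suc x) = eqb-refl x

eqb-≢ : ∀ x y → x ≢ y → eqb x y ≡ 0
eqb-≢ zero zero x≢y = contradiction refl x≢y
eqb-≢ zero (suc y) _ = refl
eqb-≢ (suc x) zero _ = refl
eqb-≢ (suc x) (suc y) x≢y = eqb-≢ x y (λ e → x≢y (cong suc e))

ltb≤1 : ∀ x B → ltb x B ≤ 1
ltb≤1 x zero = z≤n
ltb≤1 zero (suc B) = s≤s z≤n
ltb≤1 (suc x) (suc B) = ltb≤1 x B

ltb-< : ∀ x B → x < B → ltb x B ≡ 1
ltb-< zero (suc B) _ = refl
ltb-< (suc x) (suc B) (s≤s x<B) = ltb-< x B x<B

countBelow : ℕ → List ℕ → ℕ
countBelow B [] = 0
countBelow B (x ∷ xs) = ltb x B + countBelow B xs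

occurrences : ℕ → List ℕ → ℕ
occurrences u [] = 0
occurrences u (x ∷ xs) = eqb x u + occurrences u xs

countBelow-suc : ∀ B xs → countBelow (suc B) xs ≡ countBelow B xs + occurrences B xs
countBelow-suc B [] = refl
countBelow-suc B (x ∷ xs) = begin
    ltb x (suc B) + countBelow (suc B) xs
      ≡⟨ cong₂ _+_ (ltb-suc x B) (countBelow-suc B xs) ⟩
    (ltb x B + eqb x B) + (countBelow B xs + occurrences B xs)
      ≡⟨ +-assoc (ltb x B) (eqb x B) _ ⟩
    ltb x B + (eqb x B + (countBelow B xs + occurrences B xs))
      ≡⟨ cong (ltb x B +_) (+-comm (eqb x B) _) ⟩
    ltb x B + ((countBelow B xs + occurrences B xs) + eqb x B)
      ≡⟨ cong (ltb x B +_) (+-assoc (countBelow B xs) _ (eqb x B)) ⟩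
    ltb x B + (countBelow B xs + (occurrences B xs + eqb x B))
      ≡⟨ cong (λ r → ltb x B + (countBelow B xs + r)) (+-comm (occurrences B xs) (eqb x B)) ⟩
    ltb x B + (countBelow B xs + (eqb x B + occurrences B xs))
      ≡⟨ sym (+-assoc (ltb x B) _ _) ⟩
    ltb x B + countBelow B xs + (eqb x B + occurrences B xs) ∎
  where open ≡-Reasoning

countBelow-0 : ∀ xs → countBelow 0 xs ≡ 0
countBelow-0 [] = refl
countBelow-0 (x ∷ xs) = countBelow-0 xs

occurrences-∉ : ∀ u xs → All (_≢ u) xs → occurrences u xs ≡ 0
occurrences-∉ u [] _ = refl
occurrences-∉ u (x ∷ xs) (x≢u ∷ rest) = cong₂ _+_ (eqb-≢ x u x≢u) (occurrences-∉ u xs rest)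

∉⇒All≢ : ∀ {u : ℕ} xs → (u ∈ xs → ⊥) → All (_≢ u) xs
∉⇒All≢ [] _ = []
∉⇒All≢ (x ∷ xs) u∉ = (λ x≡u → u∉ (here (sym x≡u))) ∷ ∉⇒All≢ xs (λ u∈ → u∉ (there u∈))

occurrences-∈ : ∀ u xs → Unique xs → u ∈ xs → occurrences u xs ≡ 1
occurrences-∈ u (x ∷ xs) (x∉ ∷ _) (here refl) =
  cong₂ _+_ (eqb-refl u) (occurrences-∉ u xs (All.map ≢-sym x∉))
occurrences-∈ u (x ∷ xs) (x∉ ∷ unique) (there u∈xs) =
  cong₂ _+_ (eqb-≢ x u (All.lookup x∉ u∈xs)) (occurrences-∈ u xs unique u∈xs)

indicator-sum : ∀ (p : ℕ → ℕ) xs → Unique xs → Bits p →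
                (∀ u → p u ≡ 1 → u ∈ xs) → (∀ u → u ∈ xs → p u ≡ 1) →
                ∀ B → sumBelow p B ≡ countBelow B xs
indicator-sum p xs unique p01 p⇒∈ ∈⇒p zero = sym (countBelow-0 xs)
indicator-sum p xs unique p01 p⇒∈ ∈⇒p (suc B) =
  trans (cong₂ _+_ (indicator-sum p xs unique p01 p⇒∈ ∈⇒p B) p≡occ) (sym (countBelow-suc B xs))
  where
  p≡occ : p B ≡ occurrences B xs
  p≡occ with ≤1-cases (p01 B)
  ... | inj₂ pB≡1 = trans pB≡1 (sym (occurrences-∈ B xs unique (p⇒∈ B pB≡1)))
  ... | inj₁ pB≡0 = trans pB≡0 (sym (occurrences-∉ B xs (∉⇒All≢ xs λ B∈ → 0≢1+n (trans (sym pB≡0) (∈⇒p B B∈)))))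

countBelow≤length : ∀ B xs → countBelow B xs ≤ length xs
countBelow≤length B [] = z≤n
countBelow≤length B (x ∷ xs) = ≤-trans (+-monoˡ-≤ (countBelow B xs) (ltb≤1 x B)) (s≤s (countBelow≤length B xs))

-- Every entry of xs is below 1 + sum xs.
countBelow-all : ∀ k xs → sum xs ≤ k → countBelow (suc k) xs ≡ length xs
countBelow-all k [] _ = refl
countBelow-all k (x ∷ xs) sum≤k =
  cong₂ _+_ (ltb-< x (suc k) (s≤s (≤-trans (m≤m+n x (sum xs)) sum≤k)))
            (countBelow-all k xs (≤-trans (m≤n+m (sum xs) x) sum≤k))

module _ {k : ℕ} where
  colors : FinSet × Fin k × ℕ → FinSet
  colors κ = proj₁ κ

  symbol : FinSet × Fin k × ℕ → Fin k
  symbol κ = proj₁ (proj₂ κ)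

  state : FinSet × Fin k × ℕ → ℕ
  state κ = proj₂ (proj₂ κ)

  encode : FinSet × Fin k × ℕ → ℕ
  encode κ = pair (colors κ) (pair (toℕ (symbol κ)) (state κ))

colorsOf symbolOf stateOf : ℕ → ℕ
colorsOf e = unpair₁ e
symbolOf e = unpair₁ (unpair₂ e)
stateOf e = unpair₂ (unpair₂ e)

module _ {k : ℕ} (κ : FinSet × Fin k × ℕ) where
  colorsOf-encode : colorsOf (encode κ) ≡ colors κ
  colorsOf-encode = unpair₁-pair (colors κ) (pair (toℕ (symbol κ)) (state κ))

  symbolOf-encode : symbolOf (encode κ) ≡ toℕ (symbol κ)
  symbolOf-encode = trans (cong unpair₁ (unpair₂-pair (colors κ) (pair (toℕ (symbol κ)) (state κ))))
                          (unpair₁-pair (toℕ (symbol κ)) (state κ))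

  stateOf-encode : stateOf (encode κ) ≡ state κ
  stateOf-encode = trans (cong unpair₂ (unpair₂-pair (colors κ) (pair (toℕ (symbol κ)) (state κ))))
                         (unpair₂-pair (toℕ (symbol κ)) (state κ))

encode-injective : ∀ {k} (κ κ' : FinSet × Fin k × ℕ) → encode κ ≡ encode κ' → κ ≡ κ'
encode-injective (c , z , t) (c' , z' , t') e with pair-injective e
... | c≡c' , rest with pair-injective rest
...   | z≡z' , t≡t' = cong₂ _,_ c≡c' (cong₂ _,_ (toℕ-injective z≡z') t≡t')

module _ (𝒢 : CGraph) (a : ℕ) where
  toℕ-decode : ∀ n v → toℕ (decode 𝒢 a n v) ≡ digit (suc a) n v
  toℕ-decode n zero = toℕ-fromℕ< (m%n<n n (suc (suc a)))
  toℕ-decode n (suc v) = trans (toℕ-decode (n / suc (suc a)) v) (cong (_% suc (suc a)) (sym (shiftDown-suc (suc a) v n)))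

  decode-beyond : ∀ n v → n ≤ v → decode 𝒢 a n v ≡ fzero
  decode-beyond zero zero _ = toℕ-injective (toℕ-fromℕ< (m%n<n 0 (suc (suc a))))
  decode-beyond zero (suc v) _ = decode-beyond (0 / suc (suc a)) v (subst (_≤ v) (sym (0/n≡0 (suc (suc a)))) z≤n)
  decode-beyond (suc n) (suc v) n≤v =
    decode-beyond (suc n / suc (suc a)) v (≤-pred (≤-trans (m/n<m (suc n) (suc (suc a)) (s≤s (s≤s z≤n))) n≤v))

-- The labelling and edge coloring of a computable graph, made total by
-- redirecting non-vertices to some vertex g₀.
module TotalGraph (𝒢 : CGraph) (g₀ : ℕ) (g₀∈G : g₀ ∈ᶜ CGraph.G 𝒢) where
  open CGraph 𝒢

  Vᵗ : ℕ → ℕ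
  Vᵗ v = V (into G g₀ v)

  Vᵗᶜ : Computable 1 (λ xs → Vᵗ (v0 xs))
  Vᵗᶜ = composeOn V-comp (intoᶜ G g₀ ∷ []) λ { (v ∷ []) → into-∈ G g₀ v g₀∈G }

  Vᵗ-id : ∀ v → v ∈ᶜ G → Vᵗ v ≡ V v
  Vᵗ-id v v∈G = cong V (into-id G g₀ v v∈G)

  Eᵗ : ℕ → ℕ → FinSet
  Eᵗ w v = E (into G g₀ w) (into G g₀ v)

  Eᵗᶜ : Computable 2 (λ xs → Eᵗ (v0 xs) (v1 xs))
  Eᵗᶜ = composeOn E-comp (intoᶜ G g₀ ∘ᶜ (arg0ᶜ ∷ []) ∷ intoᶜ G g₀ ∘ᶜ (arg1ᶜ ∷ []) ∷ [])
                  λ { (w ∷ v ∷ []) → into-∈ G g₀ w g₀∈G , into-∈ G g₀ v g₀∈G }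

  Eᵗ-id : ∀ w v → w ∈ᶜ G → v ∈ᶜ G → Eᵗ w v ≡ E w v
  Eᵗ-id w v w∈G v∈G = cong₂ E (into-id G g₀ w w∈G) (into-id G g₀ v v∈G)

module TotalMachine (𝒢 : CGraph) (a : ℕ) (M : Machine 𝒢 a) (CM : ComputableMachine 𝒢 a M)
                    (g₀ : ℕ) (g₀∈G : g₀ ∈ᶜ CGraph.G 𝒢) where
  open CGraph 𝒢
  open Machine M
  open ComputableMachine CM

  private
    l₀∈L : V g₀ ∈ᶜ L
    l₀∈L = V-L g₀ g₀∈G

  Tᵗ : ℕ → FinSet → ℕ → ℕ → Config 𝒢 a
  Tᵗ l c z t = Tℕ 𝒢 a M (into L (V g₀) l ∷ c ∩ᶜ C ∷ z % suc (suc a) ∷ into S s t ∷ [])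

  private
    Tᵗ-args : Computables 4 4 (λ xs → into L (V g₀) (v0 xs) ∷ v1 xs ∩ᶜ C ∷ v2 xs % suc (suc a) ∷ into S s (v3 xs) ∷ [])
    Tᵗ-args = intoᶜ L (V g₀) ∘ᶜ (arg0ᶜ ∷ []) ∷ ∩ᶜᶜ C ∘ᶜ (arg1ᶜ ∷ []) ∷
              modᶜ (suc a) ∘ᶜ (arg2ᶜ ∷ []) ∷ intoᶜ S s ∘ᶜ (arg3ᶜ ∷ []) ∷ []

    Tᵗ-valid : ∀ (xs : Vec ℕ 4) →
               TDom 𝒢 a M (into L (V g₀) (v0 xs) ∷ v1 xs ∩ᶜ C ∷ v2 xs % suc (suc a) ∷ into S s (v3 xs) ∷ [])
    Tᵗ-valid (l ∷ c ∷ z ∷ t ∷ []) = into-∈ L (V g₀) l l₀∈L , ∩ᶜ-⊆ c C , m%n<n z (suc (suc a)) , into-∈ S s t s-S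

  colorsᵗᶜ : Computable 4 (λ xs → colors (Tᵗ (v0 xs) (v1 xs) (v2 xs) (v3 xs)))
  colorsᵗᶜ = composeOn T₁-comp Tᵗ-args Tᵗ-valid

  symbolᵗᶜ : Computable 4 (λ xs → toℕ (symbol (Tᵗ (v0 xs) (v1 xs) (v2 xs) (v3 xs))))
  symbolᵗᶜ = composeOn T₂-comp Tᵗ-args Tᵗ-valid

  stateᵗᶜ : Computable 4 (λ xs → state (Tᵗ (v0 xs) (v1 xs) (v2 xs) (v3 xs)))
  stateᵗᶜ = composeOn T₃-comp Tᵗ-args Tᵗ-valid

  Tᵗ-id : ∀ l c z t → l ∈ᶜ L → c ⊆ᶜ C → t ∈ᶜ S → Tᵗ l c (toℕ z) t ≡ T l c z t
  Tᵗ-id l c z t l∈L c⊆C t∈S =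
    trans (cong₂ (λ l' c' → T l' c' ((toℕ z % suc (suc a)) mod suc (suc a)) (into S s t))
                 (into-id L (V g₀) l l∈L) (∩ᶜ-id c C c⊆C))
          (cong₂ (T l c) symbol-code (into-id S s t t∈S))
    where
    symbol-code : (toℕ z % suc (suc a)) mod suc (suc a) ≡ z
    symbol-code = toℕ-injective (trans (toℕ-fromℕ< _)
                    (trans (m%n%n≡m%n (toℕ z) (suc (suc a))) (m<n⇒m%n≡m (toℕ<n z))))

-- In a graph of constant degree d the neighbours of a vertex v can be found
-- effectively: they all lie below the least B such that d neighbours of v
-- lie below B.
module Neighbourhoods (𝒢 : CGraph) (deg : ConstantDegree 𝒢) (g₀ : ℕ) (g₀∈G : g₀ ∈ᶜ CGraph.G 𝒢) where
  open CGraph 𝒢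
  open TotalGraph 𝒢 g₀ g₀∈G

  d : ℕ
  d = proj₁ deg

  adjacent : ℕ → ℕ → ℕ
  adjacent v u = χ G u * sg (Eᵗ v u + Eᵗ u v)

  neighboursBelow : ℕ → ℕ → ℕ
  neighboursBelow v B = sumBelow (adjacent v) B

  neighboursBelowᶜ : Computable 2 (λ xs → neighboursBelow (v0 xs) (v1 xs))
  neighboursBelowᶜ = computable-ext (sumᶜ adjacentᶜ arg1ᶜ) λ { (v ∷ B ∷ []) → refl }
    where
    adjacentᶜ : Computable 3 (λ xs → adjacent (v1 xs) (v0 xs))
    adjacentᶜ = mulᶜ ∘ᶜ (χᶜ G ∘ᶜ (arg0ᶜ ∷ []) ∷
                  sgᶜ ∘ᶜ (addᶜ ∘ᶜ (Eᵗᶜ ∘ᶜ (arg1ᶜ ∷ arg0ᶜ ∷ []) ∷ Eᵗᶜ ∘ᶜ (arg0ᶜ ∷ arg1ᶜ ∷ []) ∷ []) ∷ []) ∷ [])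

  module _ {v : ℕ} (v∈G : v ∈ᶜ G) where
    private
      neighbours = proj₁ (proj₂ deg v v∈G)
      unique = proj₁ (proj₂ (proj₂ deg v v∈G))
      length≡d = proj₁ (proj₂ (proj₂ (proj₂ deg v v∈G)))
      ∈neighbours = proj₂ (proj₂ (proj₂ (proj₂ deg v v∈G)))

    adjacent≤1 : ∀ u → adjacent v u ≤ 1
    adjacent≤1 u = *-≤1 (χ≤1 G u) (sg≤1 _)

    adjacent⇒Adj : ∀ u → adjacent v u ≡ 1 → Adj 𝒢 v u
    adjacent⇒Adj u adj≡1 with *-positive (χ G u) _ (subst (0 <_) (sym adj≡1) (s≤s z≤n))
    ... | in-G , some-edge = u∈G , edge
      where
      u∈G = χ-positive G u in-G
      edge-sum : 0 < E v u + E u v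
      edge-sum = subst (0 <_) (cong₂ _+_ (Eᵗ-id v u v∈G u∈G) (Eᵗ-id u v u∈G v∈G))
                   (sg≡1 _ (≤1-positive (sg≤1 _) some-edge))
      edge : E v u ≢ ∅ₛ ⊎ E u v ≢ ∅ₛ
      edge with E v u ≟ 0
      ... | no Evu≢∅ = inj₁ Evu≢∅
      ... | yes Evu≡∅ = inj₂ λ Euv≡∅ → contradiction (subst (0 <_) (cong₂ _+_ Evu≡∅ Euv≡∅) edge-sum) (<-irrefl refl)

    Adj⇒adjacent : ∀ u → Adj 𝒢 v u → adjacent v u ≡ 1
    Adj⇒adjacent u (u∈G , edge) =
      cong₂ _*_ (χ-member G u u∈G)
        (trans (cong sg (cong₂ _+_ (Eᵗ-id v u v∈G u∈G) (Eᵗ-id u v u∈G v∈G))) (sg-positive (edge-sum edge)))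
      where
      edge-sum : E v u ≢ ∅ₛ ⊎ E u v ≢ ∅ₛ → 0 < E v u + E u v
      edge-sum (inj₁ Evu≢∅) = ≤-trans (n≢0⇒n>0 Evu≢∅) (m≤m+n _ _)
      edge-sum (inj₂ Euv≢∅) = ≤-trans (n≢0⇒n>0 Euv≢∅) (m≤n+m _ _)

    private
      neighboursBelow≡ : ∀ B → neighboursBelow v B ≡ countBelow B neighbours
      neighboursBelow≡ = indicator-sum (adjacent v) neighbours unique adjacent≤1
        (λ u adj≡1 → Equivalence.to (∈neighbours u) (adjacent⇒Adj u adj≡1))
        (λ u u∈ → Adj⇒adjacent u (Equivalence.from (∈neighbours u) u∈))

    neighboursBelow≤d : ∀ B → neighboursBelow v B ≤ d
    neighboursBelow≤d B = subst (neighboursBelow v B ≤_) length≡d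
                            (subst (_≤ _) (sym (neighboursBelow≡ B)) (countBelow≤length B neighbours))

    neighboursBelow-all : neighboursBelow v (suc (sum neighbours)) ≡ d
    neighboursBelow-all = trans (neighboursBelow≡ _) (trans (countBelow-all (sum neighbours) neighbours ≤-refl) length≡d)

  -- Vanishes once all neighbours of v lie below B, and for v ∉ G.
  missing : ℕ → ℕ → ℕ
  missing v B = χ G v * dist (neighboursBelow v B) d

  missing-vanishes : ∀ v → Σ ℕ λ B → missing v B ≡ 0
  missing-vanishes v with χ-cases G v
  ... | inj₂ v∉G = 0 , cong (_* dist (neighboursBelow v 0) d) v∉G
  ... | inj₁ v∈G = suc (sum (proj₁ (proj₂ deg v v∈G))) ,
    trans (χ-∈-* G v _ v∈G) (trans (cong (λ k → dist k d) (neighboursBelow-all v∈G)) (dist-refl d))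

  abstract
    neighbourBound : ℕ → ℕ
    neighbourBound v = proj₁ (leastZero (missing v) (proj₁ (missing-vanishes v)) (proj₂ (missing-vanishes v)))

    neighbourBound-least : ∀ v → IsLeastZero (missing v) (neighbourBound v)
    neighbourBound-least v = proj₂ (leastZero (missing v) (proj₁ (missing-vanishes v)) (proj₂ (missing-vanishes v)))

  neighbourBoundᶜ : Computable 1 (λ xs → neighbourBound (v0 xs))
  neighbourBoundᶜ = minimiseᶜ missingᶜ (λ xs → neighbourBound (v0 xs)) λ { (v ∷ []) → neighbourBound-least v }
    where
    missingᶜ : Computable 2 (λ xs → missing (v1 xs) (v0 xs))
    missingᶜ = mulᶜ ∘ᶜ (χᶜ G ∘ᶜ (arg1ᶜ ∷ []) ∷
                        distᶜ ∘ᶜ (neighboursBelowᶜ ∘ᶜ (arg1ᶜ ∷ arg0ᶜ ∷ []) ∷ constᶜ d ∷ []) ∷ [])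

  neighbour<bound : ∀ {v u} → v ∈ᶜ G → Adj 𝒢 v u → u < neighbourBound v
  neighbour<bound {v} {u} v∈G adj = ≰⇒> too-many
    where
    all-below : neighboursBelow v (neighbourBound v) ≡ d
    all-below = dist≡0 _ d (trans (sym (χ-∈-* G v _ v∈G)) (proj₁ (neighbourBound-least v)))
    too-many : ¬ (neighbourBound v ≤ u)
    too-many nb≤u = <-irrefl refl (≤-trans d<count (neighboursBelow≤d v∈G (suc u)))
      where
      d<count : suc d ≤ neighboursBelow v (suc u)
      d<count = subst (_≤ neighboursBelow v (suc u)) (trans (+-comm _ 1) (cong suc all-below))
                  (+-mono-≤ (sumBelow-mono (adjacent v) nb≤u) (≤-reflexive (sym (Adj⇒adjacent v∈G u adj))))

  widen : ℕ → ℕ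
  widen K = K + sumBelow neighbourBound K

  widenᶜ : Computable 1 (λ xs → widen (v0 xs))
  widenᶜ = addᶜ ∘ᶜ (arg0ᶜ ∷ sumᶜ (neighbourBoundᶜ ∘ᶜ (arg0ᶜ ∷ [])) arg0ᶜ ∷ [])

  widen-≥ : ∀ K → K ≤ widen K
  widen-≥ K = m≤m+n K _

  widen-mono : ∀ {K K'} → K ≤ K' → widen K ≤ widen K'
  widen-mono K≤K' = +-mono-≤ K≤K' (sumBelow-mono neighbourBound K≤K')

  neighbour<widen : ∀ {u w K} → u < K → u ∈ᶜ G → Adj 𝒢 u w → w < widen K
  neighbour<widen {u} {K = K} u<K u∈G adj =
    <-≤-trans (neighbour<bound u∈G adj) (≤-trans (sumBelow-≥ neighbourBound K u u<K) (m≤n+m _ K))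

  -- reach i K: widen iterated i times.  The configuration at stage i of a
  -- vertex v only depends on the vertices below reach i (v + 1).
  reach : ℕ → ℕ → ℕ
  reach zero K = K
  reach (suc i) K = widen (reach i K)

  reachᶜ : Computable 2 (λ xs → reach (v0 xs) (v1 xs))
  reachᶜ = computable-ext (primRecᶜ arg0ᶜ (widenᶜ ∘ᶜ (arg1ᶜ ∷ []))) spec
    where
    spec : ∀ xs → _ ≡ reach (v0 xs) (v1 xs)
    spec (zero ∷ K ∷ []) = refl
    spec (suc i ∷ K ∷ []) = cong widen (spec (i ∷ K ∷ []))

  reach-≥ : ∀ i K → K ≤ reach i K
  reach-≥ zero K = ≤-refl
  reach-≥ (suc i) K = ≤-trans (reach-≥ i K) (widen-≥ _)

  reach-mono : ∀ i {K K'} → K ≤ K' → reach i K ≤ reach i K'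
  reach-mono zero K≤K' = K≤K'
  reach-mono (suc i) K≤K' = widen-mono (reach-mono i K≤K')

  reach-widen : ∀ i K → reach i (widen K) ≡ widen (reach i K)
  reach-widen zero K = refl
  reach-widen (suc i) K = cong widen (reach-widen i K)

  reach-neighbour : ∀ i {v w K} → v ∈ᶜ G → Adj 𝒢 v w → reach (suc i) (suc v) ≤ K → reach i (suc w) ≤ K
  reach-neighbour i {v} v∈G adj reach≤K =
    ≤-trans (reach-mono i (neighbour<widen (n<1+n v) v∈G adj)) (subst (_≤ _) (sym (reach-widen i (suc v))) reach≤K)

module Simulation (𝒢 : CGraph) (deg : ConstantDegree 𝒢) (a : ℕ) (M : Machine 𝒢 a) (CM : ComputableMachine 𝒢 a M)
                  (g₀ : ℕ) (g₀∈G : g₀ ∈ᶜ CGraph.G 𝒢) where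
  open CGraph 𝒢
  open Machine M
  open TotalGraph 𝒢 g₀ g₀∈G
  open TotalMachine 𝒢 a M CM g₀ g₀∈G
  open Neighbourhoods 𝒢 deg g₀ g₀∈G

  initial : ℕ → ℕ → ℕ
  initial n u = pair 0 (pair (digit (suc a) n u) s)

  arrives : ℕ → ℕ → ℕ → ℕ → ℕ → ℕ
  arrives K Lt v c w = χ G w * (bit (Eᵗ w v) c * bit (colorsOf (entry Lt K w)) c)

  colorBound : ℕ → ℕ
  colorBound v = sumBelow (λ w → Eᵗ w v) (neighbourBound v)

  incoming : ℕ → ℕ → ℕ → FinSet
  incoming K Lt v = fromBits (λ c → sg (sumBelow (arrives K Lt v c) (neighbourBound v))) (colorBound v)

  step : ℕ → ℕ → ℕ → ℕ
  step K Lt v = encode (Tᵗ (Vᵗ v) (incoming K Lt v) (symbolOf (entry Lt K v)) (stateOf (entry Lt K v)))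

  table : ℕ → ℕ → ℕ → ℕ
  table n K zero = tuple (initial n) K
  table n K (suc i) = tuple (step K (table n K i)) K

  incomingᶜ : Computable 3 (λ xs → incoming (v1 xs) (v2 xs) (v0 xs))
  incomingᶜ = computable-ext
    (fromBitsᶜ (sgᶜ ∘ᶜ (sumᶜ arrivesᶜ (neighbourBoundᶜ ∘ᶜ (arg1ᶜ ∷ [])) ∷ []))
               (sumᶜ (Eᵗᶜ ∘ᶜ (arg0ᶜ ∷ arg1ᶜ ∷ [])) (neighbourBoundᶜ ∘ᶜ (arg0ᶜ ∷ []))))
    λ { (v ∷ K ∷ Lt ∷ []) → refl }
    where
    -- arguments w, c, v, K, Lt
    arrivesᶜ : Computable 5 (λ xs → arrives (v3 xs) (v4 xs) (v2 xs) (v1 xs) (v0 xs))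
    arrivesᶜ = mulᶜ ∘ᶜ (χᶜ G ∘ᶜ (arg0ᶜ ∷ []) ∷
                 mulᶜ ∘ᶜ (bitᶜ ∘ᶜ (Eᵗᶜ ∘ᶜ (arg0ᶜ ∷ arg2ᶜ ∷ []) ∷ arg1ᶜ ∷ []) ∷
                          bitᶜ ∘ᶜ (unpair₁ᶜ ∘ᶜ (entryᶜ ∘ᶜ (arg4ᶜ ∷ arg3ᶜ ∷ arg0ᶜ ∷ []) ∷ []) ∷ arg1ᶜ ∷ []) ∷ []) ∷ [])

  -- arguments v, K, Lt
  stepᶜ : Computable 3 (λ xs → step (v1 xs) (v2 xs) (v0 xs))
  stepᶜ = pairᶜ ∘ᶜ (colorsᵗᶜ ∘ᶜ Targs ∷ pairᶜ ∘ᶜ (symbolᵗᶜ ∘ᶜ Targs ∷ stateᵗᶜ ∘ᶜ Targs ∷ []) ∷ [])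
    where
    current : Computable 3 (λ xs → entry (v2 xs) (v1 xs) (v0 xs))
    current = entryᶜ ∘ᶜ (arg2ᶜ ∷ arg1ᶜ ∷ arg0ᶜ ∷ [])
    Targs = Vᵗᶜ ∘ᶜ (arg0ᶜ ∷ []) ∷ incomingᶜ ∷ unpair₁ᶜ ∘ᶜ (unpair₂ᶜ ∘ᶜ (current ∷ []) ∷ []) ∷
            unpair₂ᶜ ∘ᶜ (unpair₂ᶜ ∘ᶜ (current ∷ []) ∷ []) ∷ []

  -- arguments i, n, K
  tableᶜ : Computable 3 (λ xs → table (v1 xs) (v2 xs) (v0 xs))
  tableᶜ = computable-ext (primRecᶜ initialTableᶜ nextTableᶜ) spec
    where
    initialTableᶜ : Computable 2 (λ xs → tuple (initial (v0 xs)) (v1 xs))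
    initialTableᶜ = computable-ext
      (tupleᶜ (pairᶜ ∘ᶜ (zeroᶜ ∷ pairᶜ ∘ᶜ (digitᶜ (suc a) ∘ᶜ (arg1ᶜ ∷ arg0ᶜ ∷ []) ∷ constᶜ s ∷ []) ∷ [])) arg1ᶜ)
      λ { (n ∷ K ∷ []) → refl }
    nextTableᶜ : Computable 4 (λ xs → tuple (step (v3 xs) (v1 xs)) (v3 xs))
    nextTableᶜ = computable-ext (tupleᶜ (stepᶜ ∘ᶜ (arg0ᶜ ∷ arg4ᶜ ∷ arg2ᶜ ∷ [])) arg3ᶜ)
      λ { (i ∷ Lt ∷ n ∷ K ∷ []) → refl }
    spec : ∀ xs → _ ≡ table (v1 xs) (v2 xs) (v0 xs)
    spec (zero ∷ n ∷ K ∷ []) = refl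
    spec (suc i ∷ n ∷ K ∷ []) = cong (λ Lt → tuple (step K Lt) K) (spec (i ∷ n ∷ K ∷ []))

  -- The coded configuration of v at stage m, read off a table that is large
  -- enough to determine it (kept abstract: only its defining equation and
  -- its computability are used).
  abstract
    configuration : ℕ → ℕ → ℕ → ℕ
    configuration n m v = entry (table n (reach m (suc v)) m) (reach m (suc v)) v

    configuration-unfold : ∀ n m v → configuration n m v ≡ entry (table n (reach m (suc v)) m) (reach m (suc v)) v
    configuration-unfold n m v = refl

    configurationᶜ : Computable 3 (λ xs → configuration (v0 xs) (v1 xs) (v2 xs))
    configurationᶜ = computable-ext (entryᶜ ∘ᶜ (tableᶜ ∘ᶜ (arg1ᶜ ∷ arg0ᶜ ∷ bound ∷ []) ∷ bound ∷ arg2ᶜ ∷ []))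
      λ { (n ∷ m ∷ v ∷ []) → refl }
      where
      bound : Computable 3 (λ xs → reach (v1 xs) (suc (v2 xs)))
      bound = reachᶜ ∘ᶜ (arg1ᶜ ∷ sucᶜ ∘ᶜ (arg2ᶜ ∷ []) ∷ [])

  changes : ℕ → ℕ → ℕ
  changes n m = sumBelow (λ v → χ G v * dist (configuration n m v) (configuration n (suc m) v)) (reach (suc m) n)

  -- arguments m, n
  changesᶜ : Computable 2 (λ xs → changes (v1 xs) (v0 xs))
  changesᶜ = computable-ext (sumᶜ changedᶜ (reachᶜ ∘ᶜ (sucᶜ ∘ᶜ (arg0ᶜ ∷ []) ∷ arg1ᶜ ∷ [])))
    λ { (m ∷ n ∷ []) → refl }
    where
    -- arguments v, m, n
    changedᶜ : Computable 3 (λ xs → χ G (v0 xs) * dist (configuration (v2 xs) (v1 xs) (v0 xs))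
                                                       (configuration (v2 xs) (suc (v1 xs)) (v0 xs)))
    changedᶜ = mulᶜ ∘ᶜ (χᶜ G ∘ᶜ (arg0ᶜ ∷ []) ∷
                 distᶜ ∘ᶜ (configurationᶜ ∘ᶜ (arg2ᶜ ∷ arg1ᶜ ∷ arg0ᶜ ∷ []) ∷
                           configurationᶜ ∘ᶜ (arg2ᶜ ∷ sucᶜ ∘ᶜ (arg1ᶜ ∷ []) ∷ arg0ᶜ ∷ []) ∷ []) ∷ [])

  rest : Config 𝒢 a
  rest = (∅ₛ , fzero , s)

  rest? : (κ : Config 𝒢 a) → Dec (κ ≡ rest)
  rest? κ = map′ (encode-injective κ rest) (cong encode) (encode κ ≟ encode rest)

  module _ (n : ℕ) {r : ℕ → ℕ → Config 𝒢 a} (run : IsRun 𝒢 a M (hat 𝒢 a M (decode 𝒢 a n)) r) where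
    arrived : ∀ m v → v ∈ᶜ G → FinSet
    arrived m v v∈G = proj₁ (proj₂ run m v v∈G)

    arrived-from : ∀ m v (v∈G : v ∈ᶜ G) c → c ∈ₛ arrived m v v∈G →
                   Σ ℕ λ w → w ∈ᶜ G × c ∈ₛ E w v × c ∈ₛ colors (r m w)
    arrived-from m v v∈G c = Equivalence.to (proj₁ (proj₂ (proj₂ run m v v∈G)) c)

    arrived-by : ∀ m v (v∈G : v ∈ᶜ G) c w → w ∈ᶜ G → c ∈ₛ E w v → c ∈ₛ colors (r m w) → c ∈ₛ arrived m v v∈G
    arrived-by m v v∈G c w w∈G c∈E c∈w = Equivalence.from (proj₁ (proj₂ (proj₂ run m v v∈G)) c) (w , w∈G , c∈E , c∈w)

    transition : ∀ m v (v∈G : v ∈ᶜ G) → r (suc m) v ≡ T (V v) (arrived m v v∈G) (symbol (r m v)) (state (r m v))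
    transition m v v∈G = proj₂ (proj₂ (proj₂ run m v v∈G))

    arrived-admissible : ∀ m v (v∈G : v ∈ᶜ G) → arrived m v v∈G ⊆ₛ γ (V v)
    arrived-admissible m v v∈G c c∈ with arrived-from m v v∈G c c∈
    ... | w , w∈G , c∈E , _ = proj₂ (E-γ w v w∈G v∈G c c∈E)

    arrived-colors : ∀ m v (v∈G : v ∈ᶜ G) → arrived m v v∈G ⊆ᶜ C
    arrived-colors m v v∈G c c∈ = γ-C (V v) (V-L v v∈G) c (arrived-admissible m v v∈G c c∈)

    state-admissible : ∀ m v → v ∈ᶜ G → state (r m v) ∈ₛ α (V v)
    state-admissible zero v v∈G = subst (λ κ → state κ ∈ₛ α (V v)) (sym (proj₁ run v v∈G)) (s-α (V v) (V-L v v∈G))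
    state-admissible (suc m) v v∈G = subst (λ κ → state κ ∈ₛ α (V v)) (sym (transition m v v∈G))
      (proj₂ (T-in (V v) (arrived m v v∈G) _ _ (V-L v v∈G) (arrived-colors m v v∈G)
                   (α-S (V v) (V-L v v∈G) _ (state-admissible m v v∈G))
                   (arrived-admissible m v v∈G) (state-admissible m v v∈G)))

    incoming-correct : ∀ K Lt i v (v∈G : v ∈ᶜ G) → reach (suc i) (suc v) ≤ K →
                       (∀ w → w ∈ᶜ G → reach i (suc w) ≤ K → entry Lt K w ≡ encode (r i w)) →
                       incoming K Lt v ≡ arrived i v v∈G
    incoming-correct K Lt i v v∈G reach≤K recorded = finset-ext _ _ sound complete
      where
      β : ℕ → ℕ
      β c = sg (sumBelow (arrives K Lt v c) (neighbourBound v))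

      β01 : Bits β
      β01 c = sg≤1 _

      colors-recorded : ∀ w → w ∈ᶜ G → Adj 𝒢 v w → colorsOf (entry Lt K w) ≡ colors (r i w)
      colors-recorded w w∈G adj =
        trans (cong colorsOf (recorded w w∈G (reach-neighbour i v∈G adj reach≤K))) (colorsOf-encode (r i w))

      sound : ∀ c → c ∈ₛ incoming K Lt v → c ∈ₛ arrived i v v∈G
      sound c c∈ with sumBelow-positive (arrives K Lt v c) (neighbourBound v) (sg≡1 _ (proj₂ (∈-fromBits β β01 (colorBound v) c c∈)))
      ... | w , _ , arrives>0 with *-positive (χ G w) _ arrives>0
      ...   | in-G , on-both with *-positive (bit (Eᵗ w v) c) _ on-both
      ...     | on-edge , emitted = arrived-by i v v∈G c w w∈G c∈E c∈w
        where
        w∈G = χ-positive G w in-G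
        c∈E : c ∈ₛ E w v
        c∈E = subst (λ e → c ∈ₛ e) (Eᵗ-id w v w∈G v∈G) (≤1-positive (bit≤1 _ c) on-edge)
        c∈w : c ∈ₛ colors (r i w)
        c∈w = subst (λ e → c ∈ₛ e) (colors-recorded w w∈G (w∈G , inj₂ (∈ₛ⇒≢∅ (E w v) c c∈E)))
                (≤1-positive (bit≤1 _ c) emitted)

      complete : ∀ c → c ∈ₛ arrived i v v∈G → c ∈ₛ incoming K Lt v
      complete c c∈ with arrived-from i v v∈G c c∈
      ... | w , w∈G , c∈E , c∈w = trans (bit-fromBits-< β β01 (colorBound v) c c<bound) (sg-positive sum≥1)
        where
        adj : Adj 𝒢 v w
        adj = w∈G , inj₂ (∈ₛ⇒≢∅ (E w v) c c∈E)
        w<nb : w < neighbourBound v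
        w<nb = neighbour<bound v∈G adj
        c<bound : c < colorBound v
        c<bound = <-≤-trans (∈ₛ⇒< _ c c∈E)
                    (subst (_≤ colorBound v) (Eᵗ-id w v w∈G v∈G) (sumBelow-≥ (λ u → Eᵗ u v) (neighbourBound v) w w<nb))
        arrives≡1 : arrives K Lt v c w ≡ 1
        arrives≡1 = cong₂ _*_ (χ-member G w w∈G)
                      (cong₂ _*_ (trans (cong (λ e → bit e c) (Eᵗ-id w v w∈G v∈G)) c∈E)
                                 (trans (cong (λ e → bit e c) (colors-recorded w w∈G adj)) c∈w))
        sum≥1 : 1 ≤ sumBelow (arrives K Lt v c) (neighbourBound v)
        sum≥1 = subst (_≤ sumBelow (arrives K Lt v c) (neighbourBound v)) arrives≡1
                  (sumBelow-≥ (arrives K Lt v c) (neighbourBound v) w w<nb)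

    table-correct : ∀ K i v → v ∈ᶜ G → reach i (suc v) ≤ K → entry (table n K i) K v ≡ encode (r i v)
    table-correct K zero v v∈G v<K = begin
        entry (tuple (initial n) K) K v       ≡⟨ entry-tuple (initial n) K v v<K ⟩
        initial n v                           ≡⟨ cong (λ z → pair 0 (pair z s)) (sym (toℕ-decode 𝒢 a n v)) ⟩
        encode (hat 𝒢 a M (decode 𝒢 a n) v)  ≡⟨ cong encode (sym (proj₁ run v v∈G)) ⟩
        encode (r 0 v)                        ∎
      where open ≡-Reasoning
    table-correct K (suc i) v v∈G reach≤K = begin
        entry (tuple (step K Lt) K) K v
          ≡⟨ entry-tuple (step K Lt) K v (≤-trans (reach-≥ (suc i) (suc v)) reach≤K) ⟩
        encode (Tᵗ (Vᵗ v) (incoming K Lt v) (symbolOf current) (stateOf current))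
          ≡⟨ cong₂ (λ l X → encode (Tᵗ l X (symbolOf current) (stateOf current))) (Vᵗ-id v v∈G)
                   (incoming-correct K Lt i v v∈G reach≤K (λ w w∈G → table-correct K i w w∈G)) ⟩
        encode (Tᵗ (V v) X (symbolOf current) (stateOf current))
          ≡⟨ cong₂ (λ z t → encode (Tᵗ (V v) X z t))
                   (trans (cong symbolOf current-correct) (symbolOf-encode (r i v)))
                   (trans (cong stateOf current-correct) (stateOf-encode (r i v))) ⟩
        encode (Tᵗ (V v) X (toℕ (symbol (r i v))) (state (r i v)))
          ≡⟨ cong encode (Tᵗ-id (V v) X (symbol (r i v)) (state (r i v)) (V-L v v∈G) (arrived-colors i v v∈G)
                                 (α-S (V v) (V-L v v∈G) _ (state-admissible i v v∈G))) ⟩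
        encode (T (V v) X (symbol (r i v)) (state (r i v)))
          ≡⟨ cong encode (sym (transition i v v∈G)) ⟩
        encode (r (suc i) v) ∎
      where
      open ≡-Reasoning
      Lt = table n K i
      current = entry Lt K v
      X = arrived i v v∈G
      current-correct : current ≡ encode (r i v)
      current-correct = table-correct K i v v∈G (≤-trans (widen-≥ _) reach≤K)

    configuration-correct : ∀ m v → v ∈ᶜ G → configuration n m v ≡ encode (r m v)
    configuration-correct m v v∈G = trans (configuration-unfold n m v) (table-correct (reach m (suc v)) m v v∈G ≤-refl)

    -- Quiescence: the input is 0 from position n on, and a vertex can only
    -- leave its rest configuration when a neighbour emits a color to it; so
    -- at stage m every vertex not at rest lies below reach m n.
    active-below : ∀ m v → v ∈ᶜ G → r m v ≢ rest → v < reach m n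
    active-below zero v v∈G active with v <? n
    ... | yes v<n = v<n
    ... | no v≮n = contradiction
      (trans (proj₁ run v v∈G) (cong (λ z → (∅ₛ , z , s)) (decode-beyond 𝒢 a n v (≮⇒≥ v≮n)))) active
    active-below (suc m) v v∈G active with rest? (r m v)
    ... | no was-active = <-≤-trans (active-below m v v∈G was-active) (widen-≥ _)
    ... | yes was-rest with arrived m v v∈G ≟ ∅ₛ
    ...   | yes nothing-arrived = contradiction stays-at-rest active
      where
      stays-at-rest : r (suc m) v ≡ rest
      stays-at-rest = trans (transition m v v∈G)
        (trans (cong₂ (λ X κ → T (V v) X (symbol κ) (state κ)) nothing-arrived was-rest) (T-rest (V v) (V-L v v∈G)))
    ...   | no something-arrived with nonempty-member _ something-arrived
    ...     | c , c∈ with arrived-from m v v∈G c c∈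
    ...       | w , w∈G , c∈E , c∈w = neighbour<widen w<reach w∈G (v∈G , inj₁ (∈ₛ⇒≢∅ (E w v) c c∈E))
      where
      w-active : r m w ≢ rest
      w-active w-rest = ∈ₛ⇒≢∅ (colors (r m w)) c c∈w (cong colors w-rest)
      w<reach : w < reach m n
      w<reach = active-below m w w∈G w-active

    at-rest : ∀ m v → v ∈ᶜ G → reach m n ≤ v → r m v ≡ rest
    at-rest m v v∈G reach≤v with rest? (r m v)
    ... | yes is-rest = is-rest
    ... | no active = contradiction (active-below m v v∈G active) (≤⇒≯ reach≤v)

    halts⇒no-changes : ∀ m → HaltsAt 𝒢 a M r m → changes n m ≡ 0
    halts⇒no-changes m halts = sumBelow-zero _ (reach (suc m) n) λ v _ → unchanged v
      where
      unchanged : ∀ v → χ G v * dist (configuration n m v) (configuration n (suc m) v) ≡ 0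
      unchanged v with χ-cases G v
      ... | inj₂ v∉G = cong (_* dist (configuration n m v) (configuration n (suc m) v)) v∉G
      ... | inj₁ v∈G = trans (χ-∈-* G v _ v∈G)
        (trans (cong₂ dist (configuration-correct m v v∈G) (configuration-correct (suc m) v v∈G))
               (trans (cong (λ κ → dist (encode (r m v)) (encode κ)) (sym (halts v v∈G))) (dist-refl (encode (r m v)))))

    no-changes⇒halts : ∀ m → changes n m ≡ 0 → HaltsAt 𝒢 a M r m
    no-changes⇒halts m no-changes v v∈G with v <? reach (suc m) n
    ... | yes v<reach = encode-injective (r m v) (r (suc m) v)
        (trans (sym (configuration-correct m v v∈G)) (trans same (configuration-correct (suc m) v v∈G)))
      where
      same : configuration n m v ≡ configuration n (suc m) v
      same = dist≡0 _ _ (trans (sym (χ-∈-* G v _ v∈G)) (sumBelow-zero⁻¹ _ (reach (suc m) n) v v<reach no-changes))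
    ... | no v≮reach = trans (at-rest m v v∈G (≤-trans (widen-≥ _) (≮⇒≥ v≮reach)))
                             (sym (at-rest (suc m) v v∈G (≮⇒≥ v≮reach)))

module Proof (𝒢 : CGraph) (deg : ConstantDegree 𝒢) (a : ℕ) (ζ : (ℕ → Alph 𝒢 a) → ℕ → Alph 𝒢 a)
             (g : GComputable 𝒢 a ζ) where
  open CGraph 𝒢

  X : CSet
  X = proj₁ g

  X⊆G : ∀ v → v ∈ᶜ X → v ∈ᶜ G
  X⊆G = proj₁ (proj₂ (proj₂ g))

  M : Machine 𝒢 a
  M = proj₁ (proj₂ (proj₂ (proj₂ g)))

  via : ComputableVia 𝒢 a ζ X M
  via = proj₂ (proj₂ (proj₂ (proj₂ (proj₂ g))))

  -- X is infinite, hence G has a vertex.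
  g₀ : ℕ
  g₀ = proj₁ (proj₁ (proj₂ g) 0)

  open Simulation 𝒢 deg a M (proj₁ (proj₂ (proj₂ (proj₂ (proj₂ g))))) g₀
                  (X⊆G g₀ (proj₂ (proj₂ (proj₁ (proj₂ g) 0))))

  -- The halting run of M on the input coded by n, which exists as {M} is total.
  module Execution (n : ℕ) where
    finite : FinSupp 𝒢 a M (decode 𝒢 a n)
    finite = n , λ v _ n≤v → decode-beyond 𝒢 a n v n≤v

    private
      evaluation : Σ (ℕ → Alph 𝒢 a) (MOut 𝒢 a M (decode 𝒢 a n))
      evaluation = proj₁ via (decode 𝒢 a n) finite

    output : ℕ → Alph 𝒢 a
    output = proj₁ evaluation

    out : MOut 𝒢 a M (decode 𝒢 a n) output
    out = proj₂ evaluation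

    runs : ℕ → ℕ → Config 𝒢 a
    runs = proj₁ out

    run : IsRun 𝒢 a M (hat 𝒢 a M (decode 𝒢 a n)) runs
    run = proj₁ (proj₂ out)

    stage : ℕ
    stage = proj₁ (proj₂ (proj₂ out))

    halts-at-stage : HaltsAt 𝒢 a M runs stage
    halts-at-stage = proj₁ (proj₂ (proj₂ (proj₂ out)))

    not-halting-before : ∀ i → i < stage → ¬ HaltsAt 𝒢 a M runs i
    not-halting-before = proj₁ (proj₂ (proj₂ (proj₂ (proj₂ out))))

    output-displayed : ∀ v → v ∈ᶜ G → output v ≡ symbol (runs stage v)
    output-displayed = proj₂ (proj₂ (proj₂ (proj₂ (proj₂ out))))

    stage-least : IsLeastZero (changes n) stage
    stage-least = halts⇒no-changes n run stage halts-at-stage ,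
                  λ i i<stage → n≢0⇒n>0 λ none → not-halting-before i i<stage (no-changes⇒halts n run i none)

  abstract
    haltingStage : ℕ → ℕ
    haltingStage n = Execution.stage n

    haltingStage-least : ∀ n → IsLeastZero (changes n) (haltingStage n)
    haltingStage-least n = Execution.stage-least n

  haltingStageᶜ : Computable 1 (λ xs → haltingStage (v0 xs))
  haltingStageᶜ = minimiseᶜ changesᶜ (λ xs → haltingStage (v0 xs)) λ { (n ∷ []) → haltingStage-least n }

  displayed : ℕ → ℕ → ℕ
  displayed n v = symbolOf (configuration n (haltingStage n) v)

  displayedᶜ : Computable 2 (λ xs → displayed (v0 xs) (v1 xs))
  displayedᶜ = unpair₁ᶜ ∘ᶜ (unpair₂ᶜ ∘ᶜ
                 (configurationᶜ ∘ᶜ (arg0ᶜ ∷ haltingStageᶜ ∘ᶜ (arg0ᶜ ∷ []) ∷ arg1ᶜ ∷ []) ∷ []) ∷ [])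

  displayed-correct : ∀ n v → v ∈ᶜ X → displayed n v ≡ toℕ (ζ (restrict 𝒢 a X (decode 𝒢 a n)) v)
  displayed-correct n v v∈X = begin
      symbolOf (configuration n (haltingStage n) v)
        ≡⟨ cong (λ m → symbolOf (configuration n m v)) (leastZero-unique (haltingStage-least n) stage-least) ⟩
      symbolOf (configuration n stage v)
        ≡⟨ cong symbolOf (configuration-correct n run stage v v∈G) ⟩
      symbolOf (encode (runs stage v))
        ≡⟨ symbolOf-encode (runs stage v) ⟩
      toℕ (symbol (runs stage v))
        ≡⟨ cong toℕ (sym (output-displayed v v∈G)) ⟩
      toℕ (output v)
        ≡⟨ cong toℕ (proj₂ (proj₂ (proj₂ via)) (decode 𝒢 a n) output finite out v v∈X) ⟩
      toℕ (ζ (restrict 𝒢 a X (decode 𝒢 a n)) v) ∎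
    where
    open ≡-Reasoning
    open Execution n
    v∈G = X⊆G v v∈X

  computable : ComputableFn 𝒢 a X ζ
  computable = proj₁ displayedᶜ , λ { (n ∷ v ∷ []) v∈X →
    subst (proj₁ displayedᶜ ⟨ n ∷ v ∷ [] ⟩⇓_) (displayed-correct n v v∈X) (proj₂ displayedᶜ (n ∷ v ∷ [])) }

mainTheorem5 : (𝒢 : CGraph) → ConstantDegree 𝒢 →
    (a : ℕ) (ζ : (ℕ → Alph 𝒢 a) → ℕ → Alph 𝒢 a) →
    (g : GComputable 𝒢 a ζ) → ComputableFn 𝒢 a (proj₁ g) ζ
mainTheorem5 𝒢 deg a ζ g = Proof.computable 𝒢 deg a ζ g
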